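{- Let $n\ge3$ and $p\in\{\lceil\frac n2\rceil,\dots,n\}$. The number $N(C_n,p)$ of oriented cycles $D$ with $n$ vertices and cycle index $c(D)=p$, counted up to digraph isomorphism, equals $\frac1n\sum_{d\mid\gcd(n,p)}\varphi(d)\binom{n/d}{p/d}$ if $p\neq\frac n2$, and equals $\frac{1}{2n}\sum_{d\mid\gcd(n,\frac n2)}\varphi(d)\binom{n/d}{n/(2d)}+2^{\frac n2-2}$ if $p=\frac n2$, where $\varphi$ is Euler's totient function.
   Context: An oriented cycle is a digraph whose underlying undirected graph is a cycle on its $n$ vertices (each edge carrying one of the two orientations). Drawing it in the plane in circle layout, let $r_D$ and $l_D$ be the numbers of clockwise and counterclockwise oriented edges; the cycle index is $c(D)=\max(r_D,l_D)$ (this is invariant under digraph isomorphism). -}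

module Defs where

open import Data.Nat using (ℕ; zero; suc; _+_; _*_; _/_; _⊔_)
open import Data.Nat.Divisibility using (_∣?_)
open import Data.Nat.GCD using (gcd)
open import Data.Nat.Combinatorics using (_C_)
open import Data.Nat.Properties using (_≟_)
open import Data.Bool using (Bool; true; false; if_then_else_)
open import Data.Fin using (Fin; toℕ)
import Data.Fin as F
open import Data.List using (List; []; _∷_; length; map; filter; upTo)
open import Data.Nat.ListAction using (sum)
open import Data.List.Relation.Unary.All using (All)
open import Data.List.Relation.Unary.Any using (Any)
open import Data.List.Relation.Unary.AllPairs using (AllPairs)
open import Data.Product using (Σ; _×_)
open import Data.Sum using (_⊎_)
open import Relation.Binary.PropositionalEquality using (_≡_)
open import Relation.Nullary using (¬_)
open import Function.Bundles using (_↔_; Inverse)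
open import Function using (_∘_; _⇔_)

φ : ℕ → ℕ
φ d = length (filter (λ k → gcd (suc k) d ≟ 1) (upTo d))

-- Sum of f d over the positive divisors d of g (g ≥ 1).
-- The divisor d = suc k is given to f as k, so that f can divide by suc k.
divisorSum : ℕ → (ℕ → ℕ) → ℕ
divisorSum g f = sum (map f (filter (λ k → suc k ∣? g) (upTo g)))

term : ℕ → ℕ → ℕ → ℕ
term n p k = φ (suc k) * ((n / suc k) C (p / suc k))

-- Oriented cycles on the vertex set Fin n, drawn in circle layout with
-- vertices 0,1,…,n-1 in clockwise order.  The cycle edge e_i joins vertex
-- i and vertex i+1 (mod n); an orientation o : Fin n → Bool orients e_i
-- clockwise (i → i+1) if o i = true and counterclockwise (i+1 → i) otherwise.

Next : {n : ℕ} → Fin n → Fin n → Set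
Next {n} u v = (suc (toℕ u) ≡ toℕ v) ⊎ (suc (toℕ u) ≡ n × toℕ v ≡ 0)

Arc : {n : ℕ} → (Fin n → Bool) → Fin n → Fin n → Set
Arc o u v = (Next u v × o u ≡ true) ⊎ (Next v u × o v ≡ false)

Iso : {n : ℕ} → (Fin n → Bool) → (Fin n → Bool) → Set
Iso {n} o o' = Σ (Fin n ↔ Fin n) λ f →
  (u v : Fin n) → Arc o u v ⇔ Arc o' (Inverse.to f u) (Inverse.to f v)

countTrue : {n : ℕ} → (Fin n → Bool) → ℕ
countTrue {zero} o = 0
countTrue {suc n} o = (if o F.zero then 1 else 0) + countTrue (o ∘ F.suc)

countFalse : {n : ℕ} → (Fin n → Bool) → ℕ
countFalse {zero} o = 0
countFalse {suc n} o = (if o F.zero then 0 else 1) + countFalse (o ∘ F.suc)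

cycleIndex : {n : ℕ} → (Fin n → Bool) → ℕ
cycleIndex o = countTrue o ⊔ countFalse o

IsoClassCount : (n p N : ℕ) → Set
IsoClassCount n p N = Σ (List (Fin n → Bool)) λ L →
  length L ≡ N
  × All (λ o → cycleIndex o ≡ p) L
  × AllPairs (λ o o' → ¬ Iso o o') L
  × ((o : Fin n → Bool) → cycleIndex o ≡ p → Any (Iso o) L)

-- An oriented cycle on the vertices Fin n is a binary word of length n (bit i says whether the edge
-- {i, i+1} is clockwise). For n ≥ 3 two such cycles are isomorphic exactly when their words lie in one
-- orbit of the dihedral group, where a reflection also complements the word because it reverses every
-- edge. The cycle index is invariant, so N counts the orbits of words with max(#ones, #zeros) = p, and
-- Burnside's lemma turns this into a count of fixed words. A rotation by k fixes exactly the words of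
-- period gcd(k, n), and grouping the k by this gcd (exactly φ(d) of them have gcd n/d) yields the divisor
-- sum, once for p ones and once, by complementation equally often, for n − p ones. A reflection fixes
-- only words with as many ones as zeros, so reflections contribute only when 2p = n: those of even
-- parameter reverse an edge onto itself and fix nothing, the others fix 2^(n/2) words each.

module Submission where

open import Defs
open import Data.Nat using (ℕ; _+_; _*_; _^_; _/_; _∸_; _≤_; ⌈_/2⌉)
open import Data.Nat.GCD using (gcd)
open import Data.Product using (Σ; _×_)
open import Relation.Binary.PropositionalEquality using (_≡_; _≢_)

import Algebra.Properties.CommutativeSemigroup as CommutativeSemigroupProperties
open import Data.Bool using (Bool; true; false; if_then_else_; not; _xor_)
import Data.Bool.Properties as Boolₚ
open import Data.Empty using (⊥-elim)
open import Data.Fin using (Fin; toℕ; fromℕ<)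
import Data.Fin as Fin
import Data.Fin.Properties as Finₚ
open import Data.List
  using (List; []; _∷_; _++_; map; length; filter; tabulate; allFin; cartesianProductWith; applyUpTo; upTo)
open import Data.List.Properties using (length-map; length-++; length-tabulate; map-tabulate)
open import Data.List.Membership.Propositional using (_∈_)
open import Data.List.Relation.Unary.All using (All; []; _∷_)
import Data.List.Relation.Unary.All as All
import Data.List.Relation.Unary.All.Properties as Allₚ
open import Data.List.Relation.Unary.AllPairs using (AllPairs; []; _∷_)
import Data.List.Relation.Unary.AllPairs as AllPairs
import Data.List.Relation.Unary.AllPairs.Properties as AllPairsₚ
open import Data.List.Relation.Unary.Any using (Any; here; there; any?)
import Data.List.Relation.Unary.Any as Any
import Data.List.Relation.Unary.Any.Properties as Anyₚ
open import Data.Nat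
  using (_≟_; _⊔_; zero; suc; pred; _<_; _<?_; _%_; s≤s; z≤n;
         NonZero; >-nonZero; >-nonZero⁻¹; ≢-nonZero; ≢-nonZero⁻¹)
open import Data.Nat.Combinatorics using (_C_; nCk+nC[k+1]≡[n+1]C[k+1])
open import Data.Nat.Divisibility using (_∣_; divides; _∣?_; ∣⇒≤; ∣-antisym; ∣-refl; ∣-trans)
open import Data.Nat.DivMod
  using (m%n<n; m%n%n≡m%n; m<n⇒m%n≡m; %-distribˡ-+; [m+n]%n≡m%n; n%n≡0; m∣n⇒o%n%m≡o%m;
         m≡m%n+[m/n]*n; m*[n/m]≡n; m/n*n≡m; m*n/n≡m; /-congˡ; /-congʳ; m/n≤m)
open import Data.Nat.GCD
  using (gcd-GCD; module Bézout; gcd[m,n]∣m; gcd[m,n]∣n; gcd-greatest; c*gcd[m,n]≡gcd[cm,cn]; gcd[m,n]≢0)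
open import Data.Nat.ListAction using (sum)
open import Data.Nat.Properties
  using (+-assoc; +-comm; +-identityʳ; +-suc; *-assoc; *-comm; *-identityˡ; *-identityʳ; *-zeroʳ;
         *-distribˡ-+; *-distribʳ-+; +-commutativeSemigroup; *-commutativeSemigroup;
         suc-injective; suc-pred; m*n≢0; *-cancelˡ-≡; *-cancelʳ-≡; ∸-cancelˡ-≡;
         ≤-refl; ≤-reflexive; ≤-trans; ≤-antisym; ≤-<-trans; ≤-pred; ≮⇒≥; <⇒≱; <⇒≤; m≤m+n;
         +-mono-≤; +-monoʳ-≤; +-cancelʳ-≤; *-monoˡ-≤; *-monoʳ-≤; *-monoʳ-<; *-cancelʳ-<;
         m+[n∸m]≡n; m+n∸m≡n; m+n∸n≡m; m∸n+n≡m; m∸[m∸n]≡n; ∸-+-assoc; ∸-monoˡ-≤; ∸-monoʳ-≤; ∸-monoʳ-<;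
         ⊔-comm; ⊔-idem; ⊔-sel; m≥n⇒m⊔n≡m; m≤n⇒m⊔n≡n; ⌊n/2⌋+⌈n/2⌉≡n; ⌊n/2⌋≤⌈n/2⌉)
open import Data.Nat.Tactic.RingSolver using (solve-∀)
open import Data.Product using (_,_; proj₁; proj₂; ∃; ∃₂)
import Data.Product as Product
import Data.Product.Properties as Prodₚ
open import Data.Sum using (_⊎_; inj₁; inj₂; [_,_]′)
import Data.Sum as Sum
open import Data.Vec using (Vec; lookup)
import Data.Vec as Vec
import Data.Vec.Properties as Vecₚ
open import Function using (_∘_; id; flip)
open import Function.Bundles using (_⇔_; mk⇔; Equivalence; Inverse; mk↔ₛ′)
open import Function.Definitions using (Injective)
open import Level using (0ℓ)
open import Relation.Binary.Definitions using (DecidableEquality)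
open import Relation.Binary.PropositionalEquality
  using (refl; sym; trans; cong; cong₂; subst; subst₂; module ≡-Reasoning)
open import Relation.Nullary using (¬_; contradiction; Dec; yes; no; does)
open import Relation.Nullary.Decidable using (map′)
open import Relation.Unary using (Pred; Decidable)

open ≡-Reasoning

module +-CS = CommutativeSemigroupProperties +-commutativeSemigroup
module *-CS = CommutativeSemigroupProperties *-commutativeSemigroup

-- Finite sums

module _ {a} {A : Set a} where

  ∑ : List A → (A → ℕ) → ℕ
  ∑ []       f = 0
  ∑ (x ∷ xs) f = f x + ∑ xs f

  syntax ∑ xs (λ x → e) = ∑[ x ∈ xs ] e

  ∑-cong : ∀ xs {f g : A → ℕ} → (∀ x → f x ≡ g x) → ∑ xs f ≡ ∑ xs g
  ∑-cong []       f≗g = refl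
  ∑-cong (x ∷ xs) f≗g = cong₂ _+_ (f≗g x) (∑-cong xs f≗g)

  ∑-+ : ∀ xs (f g : A → ℕ) → ∑[ x ∈ xs ] (f x + g x) ≡ ∑ xs f + ∑ xs g
  ∑-+ []       f g = refl
  ∑-+ (x ∷ xs) f g =
    trans (cong (f x + g x +_) (∑-+ xs f g)) (+-CS.interchange (f x) (g x) (∑ xs f) (∑ xs g))

  ∑-*ˡ : ∀ xs c (f : A → ℕ) → ∑[ x ∈ xs ] (c * f x) ≡ c * ∑ xs f
  ∑-*ˡ []       c f = sym (*-zeroʳ c)
  ∑-*ˡ (x ∷ xs) c f = trans (cong (c * f x +_) (∑-*ˡ xs c f)) (sym (*-distribˡ-+ c (f x) _))

  ∑-*ʳ : ∀ xs c (f : A → ℕ) → ∑[ x ∈ xs ] (f x * c) ≡ ∑ xs f * c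
  ∑-*ʳ xs c f = begin
    ∑[ x ∈ xs ] (f x * c) ≡⟨ ∑-cong xs (λ x → *-comm (f x) c) ⟩
    ∑[ x ∈ xs ] (c * f x) ≡⟨ ∑-*ˡ xs c f ⟩
    c * ∑ xs f            ≡⟨ *-comm c _ ⟩
    ∑ xs f * c            ∎

  ∑-const : ∀ xs c → ∑[ x ∈ xs ] c ≡ length xs * c
  ∑-const []       c = refl
  ∑-const (x ∷ xs) c = cong (c +_) (∑-const xs c)

  ∑-zero : ∀ xs → ∑[ x ∈ xs ] 0 ≡ 0
  ∑-zero []       = refl
  ∑-zero (x ∷ xs) = ∑-zero xs

  ∑-++ : ∀ xs ys (f : A → ℕ) → ∑ (xs ++ ys) f ≡ ∑ xs f + ∑ ys f
  ∑-++ []       ys f = refl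
  ∑-++ (x ∷ xs) ys f = trans (cong (f x +_) (∑-++ xs ys f)) (sym (+-assoc (f x) _ _))

  ∑-vanishes : ∀ {xs} {f : A → ℕ} → All (λ x → f x ≡ 0) xs → ∑ xs f ≡ 0
  ∑-vanishes []           = refl
  ∑-vanishes (fx≡0 ∷ all) = cong₂ _+_ fx≡0 (∑-vanishes all)

  ∑-mono : ∀ xs {f g : A → ℕ} → (∀ x → f x ≤ g x) → ∑ xs f ≤ ∑ xs g
  ∑-mono []       f≤g = z≤n
  ∑-mono (x ∷ xs) f≤g = +-mono-≤ (f≤g x) (∑-mono xs f≤g)

  ∑-positive : ∀ xs (f : A → ℕ) → 0 < ∑ xs f → Any (λ x → 0 < f x) xs
  ∑-positive (x ∷ xs) f 0<∑ with f x in fx≡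
  ... | zero  = there (∑-positive xs f 0<∑)
  ... | suc _ = here (subst (0 <_) (sym fx≡) (s≤s z≤n))

module _ {a b} {A : Set a} {B : Set b} where

  ∑-map : ∀ (h : A → B) xs (f : B → ℕ) → ∑ (map h xs) f ≡ ∑[ x ∈ xs ] f (h x)
  ∑-map h []       f = refl
  ∑-map h (x ∷ xs) f = cong (f (h x) +_) (∑-map h xs f)

  ∑-swap : ∀ xs ys (f : A → B → ℕ) → ∑[ x ∈ xs ] ∑ ys (f x) ≡ ∑[ y ∈ ys ] ∑[ x ∈ xs ] f x y
  ∑-swap []       ys f = sym (∑-zero ys)
  ∑-swap (x ∷ xs) ys f = begin
    ∑ ys (f x) + ∑[ x′ ∈ xs ] ∑ ys (f x′)          ≡⟨ cong (∑ ys (f x) +_) (∑-swap xs ys f) ⟩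
    ∑ ys (f x) + ∑[ y ∈ ys ] ∑[ x′ ∈ xs ] f x′ y   ≡⟨ sym (∑-+ ys (f x) _) ⟩
    ∑[ y ∈ ys ] (f x y + ∑[ x′ ∈ xs ] f x′ y)      ∎

module _ {a b c} {A : Set a} {B : Set b} {C : Set c} where

  ∑-cartesianProductWith : ∀ (h : A → B → C) xs ys (f : C → ℕ) →
    ∑ (cartesianProductWith h xs ys) f ≡ ∑[ x ∈ xs ] ∑[ y ∈ ys ] f (h x y)
  ∑-cartesianProductWith h []       ys f = refl
  ∑-cartesianProductWith h (x ∷ xs) ys f = begin
    ∑ (map (h x) ys ++ cartesianProductWith h xs ys) f
      ≡⟨ ∑-++ (map (h x) ys) _ f ⟩
    ∑ (map (h x) ys) f + ∑ (cartesianProductWith h xs ys) f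
      ≡⟨ cong₂ _+_ (∑-map (h x) ys f) (∑-cartesianProductWith h xs ys f) ⟩
    ∑[ y ∈ ys ] f (h x y) + ∑[ x′ ∈ xs ] ∑[ y ∈ ys ] f (h x′ y) ∎

  length-cartesianProductWith : ∀ (h : A → B → C) xs ys →
    length (cartesianProductWith h xs ys) ≡ length xs * length ys
  length-cartesianProductWith h []       ys = refl
  length-cartesianProductWith h (x ∷ xs) ys =
    trans (length-++ (map (h x) ys)) (cong₂ _+_ (length-map (h x) ys) (length-cartesianProductWith h xs ys))

bit : Bool → ℕ
bit b = if b then 1 else 0

indicator : ∀ {p} {P : Set p} → Dec P → ℕ
indicator d = bit (does d)

indicator-yes : ∀ {p} {P : Set p} (d : Dec P) → P → indicator d ≡ 1
indicator-yes (yes _) _  = refl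
indicator-yes (no ¬p) p  = ⊥-elim (¬p p)

indicator≤1 : ∀ {p} {P : Set p} (d : Dec P) → indicator d ≤ 1
indicator≤1 (yes _) = ≤-refl
indicator≤1 (no _)  = z≤n

indicator-no : ∀ {p} {P : Set p} (d : Dec P) → ¬ P → indicator d ≡ 0
indicator-no (yes p) ¬p = ⊥-elim (¬p p)
indicator-no (no _)  _  = refl

∑-filter : ∀ {a p} {A : Set a} {P : Pred A p} (P? : Decidable P) xs (f : A → ℕ) →
  ∑ (filter P? xs) f ≡ ∑[ x ∈ xs ] (indicator (P? x) * f x)
∑-filter P? []       f = refl
∑-filter P? (x ∷ xs) f with P? x
... | yes _ = cong₂ _+_ (sym (+-identityʳ (f x))) (∑-filter P? xs f)
... | no _  = ∑-filter P? xs f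

∑≡sum∘map : ∀ {a} {A : Set a} (xs : List A) (f : A → ℕ) → ∑ xs f ≡ sum (map f xs)
∑≡sum∘map []       f = refl
∑≡sum∘map (x ∷ xs) f = cong (f x +_) (∑≡sum∘map xs f)

-- Enumerations

module Kronecker {a} {A : Set a} (_≟_ : DecidableEquality A) where

  δ : A → A → ℕ
  δ x y = indicator (x ≟ y)

  δ-refl : ∀ x → δ x x ≡ 1
  δ-refl x = indicator-yes (x ≟ x) refl

  δ-≢ : ∀ {x y} → x ≢ y → δ x y ≡ 0
  δ-≢ {x} {y} = indicator-no (x ≟ y)

  δ-sym : ∀ x y → δ x y ≡ δ y x
  δ-sym x y with x ≟ y
  ... | yes refl = sym (δ-refl x)
  ... | no x≢y   = sym (δ-≢ (x≢y ∘ sym))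

  δ-positive : ∀ {x y} → 0 < δ x y → x ≡ y
  δ-positive {x} {y} 0<δ with x ≟ y
  ... | yes x≡y = x≡y

  record Enumerates (xs : List A) : Set a where
    constructor enumerates
    field occursOnce : ∀ x → ∑ xs (δ x) ≡ 1
  open Enumerates public

  ∈-enumeration : ∀ {xs} → Enumerates xs → ∀ x → x ∈ xs
  ∈-enumeration {xs} enum x =
    Any.map δ-positive (∑-positive xs (δ x) (subst (0 <_) (sym (occursOnce enum x)) (s≤s z≤n)))

  ∑-δ : ∀ {xs} → Enumerates xs → ∀ x (f : A → ℕ) → ∑[ y ∈ xs ] (δ x y * f y) ≡ f x
  ∑-δ {xs} enum x f = begin
    ∑[ y ∈ xs ] (δ x y * f y) ≡⟨ ∑-cong xs sift ⟩
    ∑[ y ∈ xs ] (δ x y * f x) ≡⟨ ∑-*ʳ xs (f x) (δ x) ⟩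
    ∑ xs (δ x) * f x          ≡⟨ cong (_* f x) (occursOnce enum x) ⟩
    1 * f x                   ≡⟨ *-identityˡ (f x) ⟩
    f x                       ∎
    where
    sift : ∀ y → δ x y * f y ≡ δ x y * f x
    sift y with x ≟ y
    ... | yes refl = refl
    ... | no _     = refl

module _ {a b} {A : Set a} {B : Set b} (_≟A_ : DecidableEquality A) (_≟B_ : DecidableEquality B) where
  private
    module KA = Kronecker _≟A_
    module KB = Kronecker _≟B_

  δ-injective : ∀ (h : A → B) → Injective _≡_ _≡_ h → ∀ x y → KB.δ (h x) (h y) ≡ KA.δ x y
  δ-injective h h-inj x y with x ≟A y
  ... | yes refl = KB.δ-refl (h x)
  ... | no x≢y   = KB.δ-≢ (x≢y ∘ h-inj)

module _ {a b} {A : Set a} {B : Set b} (_≟A_ : DecidableEquality A) (_≟B_ : DecidableEquality B) where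
  private
    module KA = Kronecker _≟A_
    module KB = Kronecker _≟B_

  module _ {xs : List A} {ys : List B} (xs-enum : KA.Enumerates xs) (ys-enum : KB.Enumerates ys) where

    ∑-reindex : ∀ (e : B → A) → Injective _≡_ _≡_ e → (f : A → ℕ) →
      (∀ x → 0 < f x → ∃ λ u → e u ≡ x) → ∑[ u ∈ ys ] f (e u) ≡ ∑ xs f
    ∑-reindex e e-inj f supp = begin
      ∑[ u ∈ ys ] f (e u)                             ≡⟨ ∑-cong ys (λ u → sym (KA.∑-δ xs-enum (e u) f)) ⟩
      ∑[ u ∈ ys ] ∑[ x ∈ xs ] (KA.δ (e u) x * f x)    ≡⟨ ∑-swap ys xs _ ⟩
      ∑[ x ∈ xs ] ∑[ u ∈ ys ] (KA.δ (e u) x * f x)    ≡⟨ ∑-cong xs (λ x → ∑-*ʳ ys (f x) _) ⟩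
      ∑[ x ∈ xs ] (∑[ u ∈ ys ] KA.δ (e u) x * f x)    ≡⟨ ∑-cong xs fibre ⟩
      ∑ xs f                                          ∎
      where
      fibre-size : ∀ v → ∑[ u ∈ ys ] KA.δ (e u) (e v) ≡ 1
      fibre-size v = begin
        ∑[ u ∈ ys ] KA.δ (e u) (e v)
          ≡⟨ ∑-cong ys (λ u → trans (δ-injective _≟B_ _≟A_ e e-inj u v) (KB.δ-sym u v)) ⟩
        ∑ ys (KB.δ v)                ≡⟨ KB.occursOnce ys-enum v ⟩
        1                            ∎
      fibre : ∀ x → ∑[ u ∈ ys ] KA.δ (e u) x * f x ≡ f x
      fibre x with f x in fx≡
      ... | zero  = *-zeroʳ (∑[ u ∈ ys ] KA.δ (e u) x)
      ... | suc _ with supp x (subst (0 <_) (sym fx≡) (s≤s z≤n))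
      ...   | v , refl = trans (cong (_* _) (fibre-size v)) (*-identityˡ _)

retraction⇒injective : ∀ {a b} {A : Set a} {B : Set b} {f : A → B} (g : B → A) →
  (∀ x → g (f x) ≡ x) → Injective _≡_ _≡_ f
retraction⇒injective {f = f} g g∘f≗id {x} {y} fx≡fy = trans (sym (g∘f≗id x)) (trans (cong g fx≡fy) (g∘f≗id y))

module _ {a} {A : Set a} (_≟_ : DecidableEquality A) {xs : List A} (enum : Kronecker.Enumerates _≟_ xs) where

  ∑-permute : ∀ (σ τ : A → A) → (∀ x → σ (τ x) ≡ x) → (∀ x → τ (σ x) ≡ x) →
    (f : A → ℕ) → ∑[ x ∈ xs ] f (σ x) ≡ ∑ xs f
  ∑-permute σ τ στ τσ f = ∑-reindex _≟_ _≟_ enum enum σ (retraction⇒injective τ τσ) f (λ x _ → τ x , στ x)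

module _ {a b c} {A : Set a} {B : Set b} {C : Set c}
  (_≟A_ : DecidableEquality A) (_≟B_ : DecidableEquality B) (_≟C_ : DecidableEquality C) where
  private
    module KA = Kronecker _≟A_
    module KB = Kronecker _≟B_
    module KC = Kronecker _≟C_

  cartesianProductWith-enumerates : ∀ (h : A → B → C) →
    (∀ {x x′ y y′} → h x y ≡ h x′ y′ → x ≡ x′ × y ≡ y′) → (∀ z → ∃₂ λ x y → h x y ≡ z) →
    ∀ {xs ys} → KA.Enumerates xs → KB.Enumerates ys → KC.Enumerates (cartesianProductWith h xs ys)
  cartesianProductWith-enumerates h h-inj h-surj {xs} {ys} xs-enum ys-enum = KC.enumerates once
    where
    once : ∀ z → ∑ (cartesianProductWith h xs ys) (KC.δ z) ≡ 1
    once z with h-surj z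
    ... | x₀ , y₀ , refl = begin
      ∑ (cartesianProductWith h xs ys) (KC.δ (h x₀ y₀))
        ≡⟨ ∑-cartesianProductWith h xs ys _ ⟩
      ∑[ x ∈ xs ] ∑[ y ∈ ys ] KC.δ (h x₀ y₀) (h x y)
        ≡⟨ ∑-cong xs (λ x → ∑-cong ys (δ-split x)) ⟩
      ∑[ x ∈ xs ] ∑[ y ∈ ys ] (KA.δ x₀ x * KB.δ y₀ y)
        ≡⟨ ∑-cong xs (λ x → ∑-*ˡ ys (KA.δ x₀ x) _) ⟩
      ∑[ x ∈ xs ] (KA.δ x₀ x * ∑ ys (KB.δ y₀))
        ≡⟨ ∑-cong xs (λ x → cong (KA.δ x₀ x *_) (KB.occursOnce ys-enum y₀)) ⟩
      ∑[ x ∈ xs ] (KA.δ x₀ x * 1)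
        ≡⟨ ∑-cong xs (λ x → *-identityʳ _) ⟩
      ∑ xs (KA.δ x₀)
        ≡⟨ KA.occursOnce xs-enum x₀ ⟩
      1 ∎
      where
      δ-split : ∀ x y → KC.δ (h x₀ y₀) (h x y) ≡ KA.δ x₀ x * KB.δ y₀ y
      δ-split x y with x₀ ≟A x | y₀ ≟B y
      ... | yes refl | yes refl = KC.δ-refl _
      ... | yes refl | no y₀≢y  = KC.δ-≢ (y₀≢y ∘ proj₂ ∘ h-inj)
      ... | no x₀≢x  | _        = KC.δ-≢ (x₀≢x ∘ proj₁ ∘ h-inj)

∑-allFin-suc : ∀ n (f : Fin (suc n) → ℕ) → ∑ (allFin (suc n)) f ≡ f Fin.zero + ∑[ i ∈ allFin n ] f (Fin.suc i)
∑-allFin-suc n f = cong (f Fin.zero +_) (begin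
  ∑ (tabulate Fin.suc) f          ≡⟨ cong (λ l → ∑ l f) (sym (map-tabulate id Fin.suc)) ⟩
  ∑ (map Fin.suc (allFin n)) f    ≡⟨ ∑-map Fin.suc (allFin n) f ⟩
  ∑[ i ∈ allFin n ] f (Fin.suc i) ∎)

allFin-enumerates : ∀ n → Kronecker.Enumerates Finₚ._≟_ (allFin n)
allFin-enumerates n = Kronecker.enumerates (once n)
  where
  δ : ∀ {n} → Fin n → Fin n → ℕ
  δ = Kronecker.δ Finₚ._≟_
  once : ∀ n (i : Fin n) → ∑ (allFin n) (δ i) ≡ 1
  once (suc n) Fin.zero    = trans (∑-allFin-suc n (δ Fin.zero)) (cong suc (∑-zero (allFin n)))
  once (suc n) (Fin.suc i) = trans (∑-allFin-suc n (δ (Fin.suc i))) (once n i)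

bools : List Bool
bools = true ∷ false ∷ []

bools-enumerates : Kronecker.Enumerates Boolₚ._≟_ bools
bools-enumerates = Kronecker.enumerates λ { true → refl ; false → refl }

module _ {a} {A : Set a} where

  vectors : List A → ∀ n → List (Vec A n)
  vectors xs zero    = Vec.[] ∷ []
  vectors xs (suc n) = cartesianProductWith Vec._∷_ xs (vectors xs n)

  length-vectors : ∀ xs n → length (vectors xs n) ≡ length xs ^ n
  length-vectors xs zero    = refl
  length-vectors xs (suc n) =
    trans (length-cartesianProductWith Vec._∷_ xs (vectors xs n)) (cong (length xs *_) (length-vectors xs n))

  vectors-enumerates : ∀ (_≟_ : DecidableEquality A) {xs} → Kronecker.Enumerates _≟_ xs →
    ∀ n → Kronecker.Enumerates (Vecₚ.≡-dec _≟_) (vectors xs n)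
  vectors-enumerates _≟_ enum zero    = Kronecker.enumerates λ { Vec.[] → refl }
  vectors-enumerates _≟_ enum (suc n) =
    cartesianProductWith-enumerates _≟_ (Vecₚ.≡-dec _≟_) (Vecₚ.≡-dec _≟_) Vec._∷_ Vecₚ.∷-injective
      (λ { (x Vec.∷ v) → x , v , refl }) enum (vectors-enumerates _≟_ enum n)

-- Sums over initial segments of ℕ

∑-applyUpTo : ∀ m (h : ℕ → ℕ) (f : ℕ → ℕ) → ∑ (applyUpTo h m) f ≡ ∑[ i ∈ allFin m ] f (h (toℕ i))
∑-applyUpTo zero    h f = refl
∑-applyUpTo (suc m) h f =
  trans (cong (f (h 0) +_) (∑-applyUpTo m (h ∘ suc) f)) (sym (∑-allFin-suc m (λ i → f (h (toℕ i)))))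

∑< : ℕ → (ℕ → ℕ) → ℕ
∑< m f = ∑ (upTo m) f

syntax ∑< m (λ i → e) = ∑[ i < m ] e

∑<≡∑allFin : ∀ m f → ∑< m f ≡ ∑[ i ∈ allFin m ] f (toℕ i)
∑<≡∑allFin m = ∑-applyUpTo m id

∑<-suc : ∀ m f → ∑< (suc m) f ≡ f 0 + ∑[ i < m ] f (suc i)
∑<-suc m f = cong (f 0 +_) (trans (∑-applyUpTo m suc f) (sym (∑<≡∑allFin m (f ∘ suc))))

∑<-cong : ∀ m {f g : ℕ → ℕ} → (∀ i → i < m → f i ≡ g i) → ∑< m f ≡ ∑< m g
∑<-cong zero    f≗g = refl
∑<-cong (suc m) {f} {g} f≗g = begin
  ∑< (suc m) f              ≡⟨ ∑<-suc m f ⟩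
  f 0 + ∑[ i < m ] f (suc i) ≡⟨ cong₂ _+_ (f≗g 0 (s≤s z≤n)) (∑<-cong m (λ i i<m → f≗g (suc i) (s≤s i<m))) ⟩
  g 0 + ∑[ i < m ] g (suc i) ≡⟨ sym (∑<-suc m g) ⟩
  ∑< (suc m) g              ∎

∑<-+ : ∀ a b f → ∑< (a + b) f ≡ ∑< a f + ∑[ i < b ] f (a + i)
∑<-+ zero    b f = refl
∑<-+ (suc a) b f = begin
  ∑< (suc (a + b)) f
    ≡⟨ ∑<-suc (a + b) f ⟩
  f 0 + ∑[ i < a + b ] f (suc i)
    ≡⟨ cong (f 0 +_) (∑<-+ a b (f ∘ suc)) ⟩
  f 0 + (∑[ i < a ] f (suc i) + ∑[ i < b ] f (suc (a + i)))
    ≡⟨ sym (+-assoc (f 0) _ _) ⟩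
  f 0 + ∑[ i < a ] f (suc i) + ∑[ i < b ] f (suc (a + i))
    ≡⟨ cong (_+ ∑[ i < b ] f (suc (a + i))) (sym (∑<-suc a f)) ⟩
  ∑< (suc a) f + ∑[ i < b ] f (suc a + i) ∎

∑<-last : ∀ m f → ∑< (suc m) f ≡ ∑< m f + f m
∑<-last m f = begin
  ∑< (suc m) f                ≡⟨ cong (λ k → ∑< k f) (+-comm 1 m) ⟩
  ∑< (m + 1) f                ≡⟨ ∑<-+ m 1 f ⟩
  ∑< m f + (f (m + 0) + 0)    ≡⟨ cong (λ k → ∑< m f + (f k + 0)) (+-identityʳ m) ⟩
  ∑< m f + (f m + 0)          ≡⟨ cong (∑< m f +_) (+-identityʳ (f m)) ⟩
  ∑< m f + f m                ∎

∑<-periodic : ∀ c d .{{_ : NonZero d}} (g : ℕ → ℕ) → ∑[ i < c * d ] g (i % d) ≡ c * ∑< d g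
∑<-periodic zero    d g = refl
∑<-periodic (suc c) d g = begin
  ∑[ i < d + c * d ] g (i % d)                                   ≡⟨ ∑<-+ d (c * d) _ ⟩
  ∑[ i < d ] g (i % d) + ∑[ i < c * d ] g ((d + i) % d)          ≡⟨ cong₂ _+_ (∑<-cong d (λ i i<d → cong g (m<n⇒m%n≡m i<d)))
                                                                             (∑-cong (upTo (c * d)) (cong g ∘ d+i%d≡i%d)) ⟩
  ∑< d g + ∑[ i < c * d ] g (i % d)                              ≡⟨ cong (∑< d g +_) (∑<-periodic c d g) ⟩
  ∑< d g + c * ∑< d g                                            ∎
  where
  d+i%d≡i%d : ∀ i → (d + i) % d ≡ i % d
  d+i%d≡i%d i = trans (cong (_% d) (+-comm d i)) ([m+n]%n≡m%n i d)

∑<-period2 : ∀ (g : ℕ → ℕ) → (∀ m → g (suc (suc m)) ≡ g m) → ∀ h → ∑< (h + h) g ≡ h * (g 0 + g 1)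
∑<-period2 g period zero    = refl
∑<-period2 g period (suc h) = begin
  ∑< (suc h + suc h) g
    ≡⟨ cong (λ k → ∑< (suc k) g) (+-suc h h) ⟩
  ∑< (suc (suc (h + h))) g
    ≡⟨ ∑<-suc (suc (h + h)) g ⟩
  g 0 + ∑[ i < suc (h + h) ] g (suc i)
    ≡⟨ cong (g 0 +_) (∑<-suc (h + h) (g ∘ suc)) ⟩
  g 0 + (g 1 + ∑[ i < h + h ] g (suc (suc i)))
    ≡⟨ cong (λ z → g 0 + (g 1 + z)) (trans (∑-cong (upTo (h + h)) period) (∑<-period2 g period h)) ⟩
  g 0 + (g 1 + h * (g 0 + g 1))
    ≡⟨ sym (+-assoc (g 0) (g 1) _) ⟩
  suc h * (g 0 + g 1) ∎

open Kronecker _≟_ public using () renaming (δ to δℕ; δ-refl to δℕ-refl; δ-≢ to δℕ-≢; δ-positive to δℕ-positive)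

δℕ-suc : ∀ a b → δℕ (suc a) (suc b) ≡ δℕ a b
δℕ-suc a b = δ-injective _≟_ _≟_ suc suc-injective a b

∑<-δ : ∀ m c (f : ℕ → ℕ) → c < m → ∑[ i < m ] (δℕ i c * f i) ≡ f c
∑<-δ (suc m) zero    f _ = begin
  ∑[ i < suc m ] (δℕ i 0 * f i)                    ≡⟨ ∑<-suc m (λ i → δℕ i 0 * f i) ⟩
  f 0 + 0 + ∑[ i < m ] (δℕ (suc i) 0 * f (suc i))  ≡⟨ cong₂ _+_ (+-identityʳ (f 0)) (∑-zero (upTo m)) ⟩
  f 0 + 0                                          ≡⟨ +-identityʳ (f 0) ⟩
  f 0                                              ∎
∑<-δ (suc m) (suc c) f (s≤s c<m) = begin
  ∑[ i < suc m ] (δℕ i (suc c) * f i)                  ≡⟨ ∑<-suc m (λ i → δℕ i (suc c) * f i) ⟩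
  0 + ∑[ i < m ] (δℕ (suc i) (suc c) * f (suc i))      ≡⟨ ∑-cong (upTo m) (λ i → cong (_* f (suc i)) (δℕ-suc i c)) ⟩
  ∑[ i < m ] (δℕ i c * f (suc i))                      ≡⟨ ∑<-δ m c (f ∘ suc) c<m ⟩
  f (suc c)                                            ∎

n/[n/d]≡d : ∀ n d .{{_ : NonZero d}} .{{_ : NonZero (n / d)}} → d ∣ n → n / (n / d) ≡ d
n/[n/d]≡d n d d∣n = begin
  n / (n / d)             ≡⟨ /-congˡ (sym (m/n*n≡m d∣n)) ⟩
  (n / d * d) / (n / d)   ≡⟨ /-congˡ (*-comm (n / d) d) ⟩
  (d * (n / d)) / (n / d) ≡⟨ m*n/n≡m d (n / d) ⟩
  d                       ∎

quotient-nonZero : ∀ n d .{{_ : NonZero n}} .{{_ : NonZero d}} → d ∣ n → NonZero (n / d)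
quotient-nonZero n d d∣n = ≢-nonZero λ n/d≡0 → ≢-nonZero⁻¹ n (trans (sym (m/n*n≡m d∣n)) (cong (_* d) n/d≡0))

module _ {n p : ℕ} (p≤n : p ≤ n) (n∸p≤p : n ∸ p ≤ p) where

  private
    max≡p⇒ : ∀ {x} → x ≤ n → x ⊔ (n ∸ x) ≡ p → x ≡ p ⊎ x ≡ n ∸ p
    max≡p⇒ {x} x≤n max≡p with ⊔-sel x (n ∸ x)
    ... | inj₁ max≡x   = inj₁ (trans (sym max≡x) max≡p)
    ... | inj₂ max≡n∸x = inj₂ (trans (sym (m∸[m∸n]≡n x≤n)) (cong (n ∸_) (trans (sym max≡n∸x) max≡p)))

    max[p] : p ⊔ (n ∸ p) ≡ p
    max[p] = m≥n⇒m⊔n≡m n∸p≤p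

    max[n∸p] : (n ∸ p) ⊔ (n ∸ (n ∸ p)) ≡ p
    max[n∸p] = trans (cong ((n ∸ p) ⊔_) (m∸[m∸n]≡n p≤n)) (m≤n⇒m⊔n≡n n∸p≤p)

    δ-max≡1 : ∀ {x} → x ≡ p ⊎ x ≡ n ∸ p → δℕ (x ⊔ (n ∸ x)) p ≡ 1
    δ-max≡1 (inj₁ refl) = trans (cong (λ y → δℕ y p) max[p]) (δℕ-refl p)
    δ-max≡1 (inj₂ refl) = trans (cong (λ y → δℕ y p) max[n∸p]) (δℕ-refl p)

  δ-max-complement : ∀ {x} → x ≤ n → p ≢ n ∸ p → δℕ (x ⊔ (n ∸ x)) p ≡ δℕ x p + δℕ x (n ∸ p)
  δ-max-complement {x} x≤n p≢n∸p with p ≟ x | n ∸ p ≟ x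
  ... | yes refl | _ = trans (δ-max≡1 (inj₁ refl)) (sym (cong₂ _+_ (δℕ-refl p) (δℕ-≢ p≢n∸p)))
  ... | no p≢x | yes refl =
    trans (δ-max≡1 (inj₂ refl)) (sym (cong₂ _+_ (δℕ-≢ (p≢n∸p ∘ sym)) (δℕ-refl (n ∸ p))))
  ... | no p≢x | no n∸p≢x =
    trans (δℕ-≢ (Sum.[ p≢x ∘ sym , n∸p≢x ∘ sym ] ∘ max≡p⇒ x≤n))
          (sym (cong₂ _+_ (δℕ-≢ (p≢x ∘ sym)) (δℕ-≢ (n∸p≢x ∘ sym))))

  δ-max-complement-half : ∀ {x} → x ≤ n → p ≡ n ∸ p → δℕ (x ⊔ (n ∸ x)) p ≡ δℕ x p
  δ-max-complement-half {x} x≤n p≡n∸p with p ≟ x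
  ... | yes refl = trans (δ-max≡1 (inj₁ refl)) (sym (δℕ-refl p))
  ... | no p≢x   =
    trans (δℕ-≢ (Sum.[ p≢x ∘ sym , (λ x≡n∸p → p≢x (trans p≡n∸p (sym x≡n∸p))) ] ∘ max≡p⇒ x≤n))
          (sym (δℕ-≢ (p≢x ∘ sym)))

p*2^p≡2*[2*p]*2^[p∸2] : ∀ p → 2 ≤ p → p * 2 ^ p ≡ 2 * (2 * p) * 2 ^ (p ∸ 2)
p*2^p≡2*[2*p]*2^[p∸2] p 2≤p = begin
  p * 2 ^ p                                   ≡⟨ cong (λ z → z * 2 ^ z) (sym (m+[n∸m]≡n 2≤p)) ⟩
  (2 + q) * 2 ^ (2 + q)                       ≡⟨ identity q (2 ^ q) ⟩
  2 * (2 * (2 + q)) * 2 ^ q                   ≡⟨ cong (λ z → 2 * (2 * z) * 2 ^ q) (m+[n∸m]≡n 2≤p) ⟩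
  2 * (2 * p) * 2 ^ q                         ∎
  where
  q = p ∸ 2
  identity : ∀ q t → (2 + q) * (2 * (2 * t)) ≡ 2 * (2 * (2 + q)) * t
  identity = solve-∀

⌈n/2⌉≤p⇒n∸p≤p : ∀ {n p} → ⌈ n /2⌉ ≤ p → n ∸ p ≤ p
⌈n/2⌉≤p⇒n∸p≤p {n} {p} ⌈n/2⌉≤p = ≤-trans (∸-monoˡ-≤ p n≤p+p) (≤-reflexive (m+n∸m≡n p p))
  where
  n≤p+p : n ≤ p + p
  n≤p+p = subst (_≤ p + p) (⌊n/2⌋+⌈n/2⌉≡n n)
            (+-mono-≤ (≤-trans (⌊n/2⌋≤⌈n/2⌉ n) ⌈n/2⌉≤p) ⌈n/2⌉≤p)

-- Binary words

ones : ∀ {d} → Vec Bool d → ℕ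
ones u = countTrue (lookup u)

zeros : ∀ {d} → Vec Bool d → ℕ
zeros u = countFalse (lookup u)

countTrue≡∑ : ∀ m (o : Fin m → Bool) → countTrue o ≡ ∑[ i ∈ allFin m ] bit (o i)
countTrue≡∑ zero    o = refl
countTrue≡∑ (suc m) o =
  trans (cong (bit (o Fin.zero) +_) (countTrue≡∑ m (o ∘ Fin.suc))) (sym (∑-allFin-suc m (bit ∘ o)))

countTrue-cong : ∀ {m} {o o′ : Fin m → Bool} → (∀ i → o i ≡ o′ i) → countTrue o ≡ countTrue o′
countTrue-cong {m} {o} {o′} o≗o′ =
  trans (countTrue≡∑ m o) (trans (∑-cong (allFin m) (cong bit ∘ o≗o′)) (sym (countTrue≡∑ m o′)))

countFalse≡∑ : ∀ m (o : Fin m → Bool) → countFalse o ≡ ∑[ i ∈ allFin m ] bit (not (o i))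
countFalse≡∑ zero    o = refl
countFalse≡∑ (suc m) o =
  trans (cong₂ _+_ (bit-not (o Fin.zero)) (countFalse≡∑ m (o ∘ Fin.suc))) (sym (∑-allFin-suc m (bit ∘ not ∘ o)))
  where
  bit-not : ∀ b → (if b then 0 else 1) ≡ bit (not b)
  bit-not true  = refl
  bit-not false = refl

countFalse-cong : ∀ {m} {o o′ : Fin m → Bool} → (∀ i → o i ≡ o′ i) → countFalse o ≡ countFalse o′
countFalse-cong {m} {o} {o′} o≗o′ =
  trans (countFalse≡∑ m o) (trans (∑-cong (allFin m) (cong (bit ∘ not) ∘ o≗o′)) (sym (countFalse≡∑ m o′)))

infix 4 _≟V_
_≟V_ : ∀ {d} → DecidableEquality (Vec Bool d)
_≟V_ = Vecₚ.≡-dec Boolₚ._≟_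

words : ∀ d → List (Vec Bool d)
words = vectors bools

words-enumerates : ∀ d → Kronecker.Enumerates _≟V_ (words d)
words-enumerates = vectors-enumerates Boolₚ._≟_ bools-enumerates

∑-words-suc : ∀ d (g : Vec Bool (suc d) → ℕ) →
  ∑ (words (suc d)) g ≡ ∑[ u ∈ words d ] g (true Vec.∷ u) + ∑[ u ∈ words d ] g (false Vec.∷ u)
∑-words-suc d g = trans (∑-cartesianProductWith Vec._∷_ bools (words d) g)
                        (cong (∑[ u ∈ words d ] g (true Vec.∷ u) +_) (+-identityʳ _))

∑-words-δ-ones : ∀ d t → ∑[ u ∈ words d ] δℕ (ones u) t ≡ d C t
∑-words-δ-ones zero    zero    = refl
∑-words-δ-ones zero    (suc t) = refl
∑-words-δ-ones (suc d) zero    = begin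
  ∑[ u ∈ words (suc d) ] δℕ (ones u) 0
    ≡⟨ ∑-words-suc d _ ⟩
  ∑[ u ∈ words d ] δℕ (suc (ones u)) 0 + ∑[ u ∈ words d ] δℕ (ones u) 0
    ≡⟨ cong₂ _+_ (∑-zero (words d)) (∑-words-δ-ones d 0) ⟩
  1 ∎
∑-words-δ-ones (suc d) (suc t) = begin
  ∑[ u ∈ words (suc d) ] δℕ (ones u) (suc t)
    ≡⟨ ∑-words-suc d _ ⟩
  ∑[ u ∈ words d ] δℕ (suc (ones u)) (suc t) + ∑[ u ∈ words d ] δℕ (ones u) (suc t)
    ≡⟨ cong₂ _+_ (trans (∑-cong (words d) (λ u → δℕ-suc (ones u) t)) (∑-words-δ-ones d t))
                 (∑-words-δ-ones d (suc t)) ⟩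
  d C t + d C suc t
    ≡⟨ nCk+nC[k+1]≡[n+1]C[k+1] d t ⟩
  suc d C suc t ∎

-- The term j = e of φ e reappears as j = 0, since gcd e e = gcd 0 e.
φ≡∑< : ∀ e → φ e ≡ ∑[ j < e ] δℕ (gcd j e) 1
φ≡∑< zero    = refl
φ≡∑< (suc m) = begin
  φ (suc m)
    ≡⟨ sym (trans (∑-const coprimes 1) (*-identityʳ _)) ⟩
  ∑[ k ∈ coprimes ] 1
    ≡⟨ ∑-filter (λ k → gcd (suc k) (suc m) ≟ 1) (upTo (suc m)) _ ⟩
  ∑[ k < suc m ] (g (suc k) * 1)
    ≡⟨ ∑-cong (upTo (suc m)) (λ k → *-identityʳ _) ⟩
  ∑[ k < suc m ] g (suc k)
    ≡⟨ ∑<-last m (g ∘ suc) ⟩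
  ∑[ k < m ] g (suc k) + g (suc m)
    ≡⟨ +-comm _ (g (suc m)) ⟩
  g (suc m) + ∑[ k < m ] g (suc k)
    ≡⟨ cong (λ z → δℕ z 1 + ∑[ k < m ] g (suc k)) (gcd[n,n]≡n (suc m)) ⟩
  g 0 + ∑[ k < m ] g (suc k)
    ≡⟨ sym (∑<-suc m g) ⟩
  ∑< (suc m) g ∎
  where
  g : ℕ → ℕ
  g j = δℕ (gcd j (suc m)) 1
  coprimes = filter (λ k → gcd (suc k) (suc m) ≟ 1) (upTo (suc m))
  gcd[n,n]≡n : ∀ e → gcd e e ≡ e
  gcd[n,n]≡n e = ∣-antisym (gcd[m,n]∣m e e) (gcd-greatest ∣-refl ∣-refl)

∑-words-δ-scaled : ∀ d m q .{{_ : NonZero m}} → m ∣ q → ∑[ u ∈ words d ] δℕ (m * ones u) q ≡ d C (q / m)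
∑-words-δ-scaled d m q m∣q = trans (∑-cong (words d) rescale) (∑-words-δ-ones d (q / m))
  where
  rescale : ∀ u → δℕ (m * ones u) q ≡ δℕ (ones u) (q / m)
  rescale u = trans (cong (δℕ (m * ones u)) (sym (m*[n/m]≡n m∣q)))
                    (δ-injective _≟_ _≟_ (m *_) (*-cancelˡ-≡ _ _ m) (ones u) (q / m))

∑-words-δ-scaled-∤ : ∀ d m q → ¬ m ∣ q → ∑[ u ∈ words d ] δℕ (m * ones u) q ≡ 0
∑-words-δ-scaled-∤ d m q m∤q = trans (∑-cong (words d) vanishes) (∑-zero (words d))
  where
  vanishes : ∀ u → δℕ (m * ones u) q ≡ 0
  vanishes u = δℕ-≢ λ m*ones≡q → m∤q (divides (ones u) (trans (sym m*ones≡q) (*-comm m (ones u))))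

-- Burnside's lemma

-- The orbits are counted inside an invariant decidable subset P, and only the group laws used by the
-- argument are assumed.
module Burnside
  {X G : Set} (_≟X_ : DecidableEquality X) (_≟G_ : DecidableEquality G)
  {xs : List X} {gs : List G}
  (xs-enum : Kronecker.Enumerates _≟X_ xs) (gs-enum : Kronecker.Enumerates _≟G_ gs)
  (_·_ : G → G → G) (_⁻¹ : G → G) (ε : G) (_▷_ : G → X → X)
  (·-▷ : ∀ g h x → g ▷ (h ▷ x) ≡ (g · h) ▷ x)
  (ε-▷ : ∀ x → ε ▷ x ≡ x)
  (⁻¹-▷ : ∀ g x → (g ⁻¹) ▷ (g ▷ x) ≡ x)
  (·-⁻¹-cancel : ∀ g h → (g · h) · (h ⁻¹) ≡ g)
  (·-⁻¹-cancel′ : ∀ g h → (g · (h ⁻¹)) · h ≡ g)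
  {P : Pred X 0ℓ} (P? : Decidable P) (P-invariant : ∀ g {x} → P x → P (g ▷ x))
  where

  open Kronecker _≟X_

  transporterCount : X → X → ℕ
  transporterCount r x = ∑[ g ∈ gs ] δ (g ▷ r) x

  stabiliserSize : X → ℕ
  stabiliserSize x = transporterCount x x

  fixedPointCount : G → ℕ
  fixedPointCount g = ∑[ x ∈ xs ] (indicator (P? x) * δ (g ▷ x) x)

  _∼_ : X → X → Set
  r ∼ x = ∃ λ g → g ▷ r ≡ x

  transporterCount-positive⇒∼ : ∀ r x → 0 < transporterCount r x → r ∼ x
  transporterCount-positive⇒∼ r x 0<count = Product.map₂ δ-positive (Any.satisfied (∑-positive gs _ 0<count))

  ∼⇒transporterCount-positive : ∀ r x → r ∼ x → 0 < transporterCount r x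
  ∼⇒transporterCount-positive r x (g , g▷r≡x) = ≤-trans (≤-reflexive (sym sifted)) (∑-mono gs bounded)
    where
    module KG = Kronecker _≟G_
    sifted : ∑[ h ∈ gs ] (KG.δ g h * δ (h ▷ r) x) ≡ 1
    sifted = trans (KG.∑-δ gs-enum g (λ h → δ (h ▷ r) x)) (trans (cong (λ y → δ y x) g▷r≡x) (δ-refl x))
    bounded : ∀ h → KG.δ g h * δ (h ▷ r) x ≤ δ (h ▷ r) x
    bounded h = ≤-trans (*-monoˡ-≤ (δ (h ▷ r) x) (indicator≤1 (g ≟G h))) (≤-reflexive (*-identityˡ _))

  _∼?_ : ∀ r x → Dec (r ∼ x)
  r ∼? x = map′ (transporterCount-positive⇒∼ r x) (∼⇒transporterCount-positive r x) (0 <? transporterCount r x)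

  ∼-refl : ∀ x → x ∼ x
  ∼-refl x = ε , ε-▷ x

  ∼-sym : ∀ {r x} → r ∼ x → x ∼ r
  ∼-sym {r} (g , refl) = g ⁻¹ , ⁻¹-▷ g r

  ∼-trans : ∀ {r x y} → r ∼ x → x ∼ y → r ∼ y
  ∼-trans {r} (g , refl) (h , refl) = h · g , sym (·-▷ h g r)

  P-respects-∼ : ∀ {r x} → r ∼ x → P r → P x
  P-respects-∼ (g , refl) = P-invariant g

  ∑-translate : ∀ h (f : G → ℕ) → ∑[ g ∈ gs ] f (g · h) ≡ ∑ gs f
  ∑-translate h = ∑-permute _≟G_ gs-enum (_· h) (_· (h ⁻¹)) (λ g → ·-⁻¹-cancel′ g h) (λ g → ·-⁻¹-cancel g h)

  orbit-stabiliser : ∀ r x → indicator (r ∼? x) * stabiliserSize x ≡ transporterCount r x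
  orbit-stabiliser r x with r ∼? x
  ... | no r≁x = begin
    indicator (r ∼? x) * stabiliserSize x   ≡⟨ cong (_* stabiliserSize x) (indicator-no (r ∼? x) r≁x) ⟩
    0                                       ≡⟨ ≤-antisym z≤n (≮⇒≥ (r≁x ∘ transporterCount-positive⇒∼ r x)) ⟩
    transporterCount r x                    ∎
  ... | yes (h , refl) = begin
    indicator (r ∼? (h ▷ r)) * stabiliserSize (h ▷ r)
      ≡⟨ cong (_* stabiliserSize (h ▷ r)) (indicator-yes (r ∼? (h ▷ r)) (h , refl)) ⟩
    1 * stabiliserSize (h ▷ r)
      ≡⟨ *-identityˡ _ ⟩
    ∑[ g ∈ gs ] δ (g ▷ (h ▷ r)) (h ▷ r)
      ≡⟨ ∑-cong gs (λ g → cong (λ y → δ y (h ▷ r)) (·-▷ g h r)) ⟩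
    ∑[ g ∈ gs ] δ ((g · h) ▷ r) (h ▷ r)
      ≡⟨ ∑-translate h (λ g → δ (g ▷ r) (h ▷ r)) ⟩
    transporterCount r (h ▷ r) ∎

  Covered : List X → X → Set
  Covered reps x = P x → Any (_∼ x) reps

  record Representatives (reps : List X) : Set where
    field
      all-P     : All P reps
      unrelated : AllPairs (λ r s → ¬ r ∼ s) reps

  open Representatives

  extendRepresentatives : List X → List X → List X
  extendRepresentatives reps []       = reps
  extendRepresentatives reps (x ∷ ys) with P? x | any? (_∼? x) reps
  ... | yes _ | no _ = extendRepresentatives (x ∷ reps) ys
  ... | _     | _    = extendRepresentatives reps ys

  private
    advance : ∀ {reps reps′ y ys} → (∀ {x} → Covered reps x → Covered reps′ x) → Covered reps′ y →
      (∀ x → Covered reps x ⊎ x ∈ y ∷ ys) → ∀ x → Covered reps′ x ⊎ x ∈ ys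
    advance keep y-covered todo x with todo x
    ... | inj₁ covered      = inj₁ (keep covered)
    ... | inj₂ (here refl)  = inj₁ y-covered
    ... | inj₂ (there x∈ys) = inj₂ x∈ys

  extendRepresentatives-correct : ∀ reps ys → Representatives reps → (∀ x → Covered reps x ⊎ x ∈ ys) →
    Representatives (extendRepresentatives reps ys) × (∀ x → Covered (extendRepresentatives reps ys) x)
  extendRepresentatives-correct reps [] R todo = R , λ x → [ id , (λ ()) ]′ (todo x)
  extendRepresentatives-correct reps (y ∷ ys) R todo with P? y | any? (_∼? y) reps
  ... | yes Py | no y-new = extendRepresentatives-correct (y ∷ reps) ys R′ (advance (there ∘_) (λ _ → here (∼-refl y)) todo)
    where
    R′ : Representatives (y ∷ reps)
    R′ = record
      { all-P     = Py ∷ all-P R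
      ; unrelated = All.map (λ r≁y y∼r → r≁y (∼-sym y∼r)) (Allₚ.¬Any⇒All¬ reps y-new) ∷ unrelated R }
  ... | yes _  | yes y-old = extendRepresentatives-correct reps ys R (advance id (λ _ → y-old) todo)
  ... | no ¬Py | _         = extendRepresentatives-correct reps ys R (advance id (λ Py → contradiction Py ¬Py) todo)

  representatives : List X
  representatives = extendRepresentatives [] xs

  representatives-correct : Representatives representatives × (∀ x → Covered representatives x)
  representatives-correct = extendRepresentatives-correct [] xs (record { all-P = [] ; unrelated = [] })
    (λ x → inj₂ (∈-enumeration xs-enum x))

  representatives-valid : Representatives representatives
  representatives-valid = proj₁ representatives-correct

  representatives-cover : ∀ x → Covered representatives x
  representatives-cover = proj₂ representatives-correct

  private
    separated : ∀ {r s x} → ¬ r ∼ s → r ∼ x → ¬ s ∼ x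
    separated r≁s r∼x s∼x = r≁s (∼-trans r∼x (∼-sym s∼x))

  ∑-indicator-unique : ∀ {reps} x → AllPairs (λ r s → ¬ r ∼ s) reps → Any (_∼ x) reps →
    ∑[ r ∈ reps ] indicator (r ∼? x) ≡ 1
  ∑-indicator-unique {r ∷ reps} x (r≁reps ∷ _) (here r∼x) =
    cong₂ _+_ (indicator-yes (r ∼? x) r∼x)
              (∑-vanishes (All.map (λ r≁s → indicator-no (_ ∼? x) (separated r≁s r∼x)) r≁reps))
  ∑-indicator-unique {r ∷ reps} x (r≁reps ∷ apart) (there any) =
    cong₂ _+_ (indicator-no (r ∼? x) r≁x) (∑-indicator-unique x apart any)
    where
    r≁x : ¬ r ∼ x
    r≁x r∼x = Allₚ.All¬⇒¬Any (All.map (λ r≁s → separated r≁s r∼x) r≁reps) any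

  ∑-indicator-representatives : ∀ x → ∑[ r ∈ representatives ] indicator (r ∼? x) ≡ indicator (P? x)
  ∑-indicator-representatives x with P? x
  ... | yes Px = ∑-indicator-unique x (unrelated representatives-valid) (representatives-cover x Px)
  ... | no ¬Px = ∑-vanishes (All.map unrelated-to-x (all-P representatives-valid))
    where
    unrelated-to-x : ∀ {r} → P r → indicator (r ∼? x) ≡ 0
    unrelated-to-x {r} Pr = indicator-no (r ∼? x) λ r∼x → ¬Px (P-respects-∼ r∼x Pr)

  burnside : length representatives * length gs ≡ ∑ gs fixedPointCount
  burnside = sym (begin
    ∑ gs fixedPointCount
      ≡⟨ ∑-swap gs xs _ ⟩
    ∑[ x ∈ xs ] ∑[ g ∈ gs ] (indicator (P? x) * δ (g ▷ x) x)
      ≡⟨ ∑-cong xs (λ x → ∑-*ˡ gs (indicator (P? x)) _) ⟩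
    ∑[ x ∈ xs ] (indicator (P? x) * stabiliserSize x)
      ≡⟨ ∑-cong xs (λ x → cong (_* stabiliserSize x) (sym (∑-indicator-representatives x))) ⟩
    ∑[ x ∈ xs ] (∑[ r ∈ reps ] indicator (r ∼? x) * stabiliserSize x)
      ≡⟨ ∑-cong xs (λ x → sym (∑-*ʳ reps (stabiliserSize x) _)) ⟩
    ∑[ x ∈ xs ] ∑[ r ∈ reps ] (indicator (r ∼? x) * stabiliserSize x)
      ≡⟨ ∑-cong xs (λ x → ∑-cong reps (λ r → orbit-stabiliser r x)) ⟩
    ∑[ x ∈ xs ] ∑[ r ∈ reps ] transporterCount r x
      ≡⟨ ∑-swap xs reps _ ⟩
    ∑[ r ∈ reps ] ∑[ x ∈ xs ] transporterCount r x
      ≡⟨ ∑-cong reps (λ r → ∑-swap xs gs _) ⟩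
    ∑[ r ∈ reps ] ∑[ g ∈ gs ] ∑ xs (δ (g ▷ r))
      ≡⟨ ∑-cong reps (λ r → ∑-cong gs (λ g → occursOnce xs-enum (g ▷ r))) ⟩
    ∑[ r ∈ reps ] ∑[ g ∈ gs ] 1
      ≡⟨ ∑-cong reps (λ r → trans (∑-const gs 1) (*-identityʳ _)) ⟩
    ∑[ r ∈ reps ] length gs
      ≡⟨ ∑-const reps _ ⟩
    length reps * length gs ∎)
    where
    reps = representatives

-- Arithmetic modulo n

module Modular (n : ℕ) .{{_ : NonZero n}} where

  infix 4 _≈_
  _≈_ : ℕ → ℕ → Set
  a ≈ b = a % n ≡ b % n

  ≈-refl : ∀ {a} → a ≈ a
  ≈-refl = refl

  ≈-sym : ∀ {a b} → a ≈ b → b ≈ a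
  ≈-sym = sym

  ≈-trans : ∀ {a b c} → a ≈ b → b ≈ c → a ≈ c
  ≈-trans = trans

  ≡⇒≈ : ∀ {a b} → a ≡ b → a ≈ b
  ≡⇒≈ = cong (_% n)

  %-≈ : ∀ a → a % n ≈ a
  %-≈ a = m%n%n≡m%n a n

  <⇒%-≡ : ∀ {a} → a < n → a % n ≡ a
  <⇒%-≡ = m<n⇒m%n≡m

  +-congʳ : ∀ {a a′} b → a ≈ a′ → a + b ≈ a′ + b
  +-congʳ {a} {a′} b a≈a′ = begin
    (a + b) % n            ≡⟨ %-distribˡ-+ a b n ⟩
    (a % n + b % n) % n    ≡⟨ cong (λ z → (z + b % n) % n) a≈a′ ⟩
    (a′ % n + b % n) % n   ≡⟨ sym (%-distribˡ-+ a′ b n) ⟩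
    (a′ + b) % n           ∎

  +-congˡ : ∀ a {b b′} → b ≈ b′ → a + b ≈ a + b′
  +-congˡ a {b} {b′} b≈b′ = trans (≡⇒≈ (+-comm a b)) (trans (+-congʳ a b≈b′) (≡⇒≈ (+-comm b′ a)))

  +-cong : ∀ {a a′ b b′} → a ≈ a′ → b ≈ b′ → a + b ≈ a′ + b′
  +-cong {a′ = a′} {b} a≈a′ b≈b′ = trans (+-congʳ b a≈a′) (+-congˡ a′ b≈b′)

  +n≈ : ∀ a → a + n ≈ a
  +n≈ a = [m+n]%n≡m%n a n

  neg : ℕ → ℕ
  neg a = n ∸ a % n

  neg-cong : ∀ {a b} → a ≈ b → neg a ≈ neg b
  neg-cong a≈b = ≡⇒≈ (cong (n ∸_) a≈b)

  +-inverseʳ : ∀ a → a + neg a ≈ 0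
  +-inverseʳ a = begin
    (a + neg a) % n               ≡⟨ +-congʳ (neg a) (≈-sym (%-≈ a)) ⟩
    (a % n + (n ∸ a % n)) % n     ≡⟨ cong (_% n) (m+[n∸m]≡n (<⇒≤ (m%n<n a n))) ⟩
    n % n                         ≡⟨ trans (n%n≡0 n) (sym (<⇒%-≡ (>-nonZero⁻¹ n))) ⟩
    0 % n                         ∎

  +-inverseˡ : ∀ a → neg a + a ≈ 0
  +-inverseˡ a = trans (≡⇒≈ (+-comm (neg a) a)) (+-inverseʳ a)

  m+n+neg[n]≈m : ∀ a b → a + b + neg b ≈ a
  m+n+neg[n]≈m a b = begin
    (a + b + neg b) % n   ≡⟨ ≡⇒≈ (+-assoc a b (neg b)) ⟩
    (a + (b + neg b)) % n ≡⟨ +-congˡ a (+-inverseʳ b) ⟩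
    (a + 0) % n           ≡⟨ ≡⇒≈ (+-identityʳ a) ⟩
    a % n                 ∎

  m+neg[n]+n≈m : ∀ a b → a + neg b + b ≈ a
  m+neg[n]+n≈m a b = begin
    (a + neg b + b) % n   ≡⟨ ≡⇒≈ (+-assoc a (neg b) b) ⟩
    (a + (neg b + b)) % n ≡⟨ +-congˡ a (+-inverseˡ b) ⟩
    (a + 0) % n           ≡⟨ ≡⇒≈ (+-identityʳ a) ⟩
    a % n                 ∎

  +-cancelʳ : ∀ {a b} c → a + c ≈ b + c → a ≈ b
  +-cancelʳ {a} {b} c a+c≈b+c = begin
    a % n             ≡⟨ ≈-sym (m+n+neg[n]≈m a c) ⟩
    (a + c + neg c) % n ≡⟨ +-congʳ (neg c) a+c≈b+c ⟩
    (b + c + neg c) % n ≡⟨ m+n+neg[n]≈m b c ⟩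
    b % n             ∎

  neg-+ : ∀ a b → neg (a + b) ≈ neg a + neg b
  neg-+ a b = +-cancelʳ (a + b) (≈-trans (+-inverseˡ (a + b)) (≈-sym cancels))
    where
    cancels : neg a + neg b + (a + b) ≈ 0
    cancels = begin
      (neg a + neg b + (a + b)) % n   ≡⟨ ≡⇒≈ (+-CS.interchange (neg a) (neg b) a b) ⟩
      (neg a + a + (neg b + b)) % n   ≡⟨ +-cong (+-inverseˡ a) (+-inverseˡ b) ⟩
      0 % n                           ∎

  neg-involutive : ∀ a → neg (neg a) ≈ a
  neg-involutive a = +-cancelʳ (neg a) (≈-trans (+-inverseˡ (neg a)) (≈-sym (+-inverseʳ a)))

  m+neg[m+neg[n]]≈n : ∀ a b → a + neg (a + neg b) ≈ b
  m+neg[m+neg[n]]≈n a b = begin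
    (a + neg (a + neg b)) % n         ≡⟨ +-congˡ a (neg-+ a (neg b)) ⟩
    (a + (neg a + neg (neg b))) % n   ≡⟨ +-congˡ a (+-congˡ (neg a) (neg-involutive b)) ⟩
    (a + (neg a + b)) % n             ≡⟨ ≡⇒≈ (sym (+-assoc a (neg a) b)) ⟩
    (a + neg a + b) % n               ≡⟨ +-congʳ b (+-inverseʳ a) ⟩
    b % n                             ∎

  1+m+neg[1+n]≈m+neg[n] : ∀ a b → suc a + neg (suc b) ≈ a + neg b
  1+m+neg[1+n]≈m+neg[n] a b = +-cancelʳ (suc b) (begin
    (suc a + neg (suc b) + suc b) % n ≡⟨ m+neg[n]+n≈m (suc a) (suc b) ⟩
    suc a % n                         ≡⟨ +-congˡ 1 (≈-sym (m+neg[n]+n≈m a b)) ⟩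
    suc (a + neg b + b) % n           ≡⟨ ≡⇒≈ (sym (+-suc (a + neg b) b)) ⟩
    (a + neg b + suc b) % n           ∎)

  toFin : ℕ → Fin n
  toFin m = fromℕ< (m%n<n m n)

  toℕ-toFin : ∀ m → toℕ (toFin m) ≡ m % n
  toℕ-toFin m = Finₚ.toℕ-fromℕ< (m%n<n m n)

  toℕ-toFin-≈ : ∀ m → toℕ (toFin m) ≈ m
  toℕ-toFin-≈ m = trans (cong (_% n) (toℕ-toFin m)) (%-≈ m)

  toFin-toℕ : ∀ (i : Fin n) → toFin (toℕ i) ≡ i
  toFin-toℕ i = Finₚ.toℕ-injective (trans (toℕ-toFin (toℕ i)) (<⇒%-≡ (Finₚ.toℕ<n i)))

  toFin-cong : ∀ {a b} → a ≈ b → toFin a ≡ toFin b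
  toFin-cong {a} {b} a≈b = Finₚ.toℕ-injective (trans (toℕ-toFin a) (trans a≈b (sym (toℕ-toFin b))))

  toFin-injective : ∀ {a b} → toFin a ≡ toFin b → a ≈ b
  toFin-injective {a} {b} eq = trans (sym (toℕ-toFin a)) (trans (cong toℕ eq) (toℕ-toFin b))

  toℕ-injective-≈ : ∀ {u v : Fin n} → toℕ u ≈ toℕ v → u ≡ v
  toℕ-injective-≈ {u} {v} u≈v = trans (sym (toFin-toℕ u)) (trans (toFin-cong u≈v) (toFin-toℕ v))

-- Oriented cycles as words, and the dihedral group

Arc-respects-≗ : ∀ {m} {o o′ : Fin m → Bool} → (∀ i → o i ≡ o′ i) → ∀ {u v} → Arc o u v → Arc o′ u v
Arc-respects-≗ o≗o′ {u}     (inj₁ (u→v , ou)) = inj₁ (u→v , trans (sym (o≗o′ u)) ou)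
Arc-respects-≗ o≗o′ {v = v} (inj₂ (v→u , ov)) = inj₂ (v→u , trans (sym (o≗o′ v)) ov)

Iso-respects-≗ : ∀ {m} {o o₂ o′ : Fin m → Bool} → (∀ i → o i ≡ o₂ i) → Iso o₂ o′ → Iso o o′
Iso-respects-≗ o≗o₂ (F , arcs) = F , λ u v →
  mk⇔ (Equivalence.to (arcs u v) ∘ Arc-respects-≗ o≗o₂) (Arc-respects-≗ (sym ∘ o≗o₂) ∘ Equivalence.from (arcs u v))

module DihedralAction (n : ℕ) .{{_ : NonZero n}} where
  open Modular n public

  Word : Set
  Word = Vec Bool n

  infix 4 _≟W_
  _≟W_ : DecidableEquality Word
  _≟W_ = _≟V_

  at : Word → ℕ → Bool
  at w m = lookup w (toFin m)

  cyclic : (ℕ → Bool) → Word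
  cyclic f = Vec.tabulate (λ i → f (toℕ i))

  at-cyclic : ∀ f m → at (cyclic f) m ≡ f (m % n)
  at-cyclic f m = trans (Vecₚ.lookup∘tabulate _ (toFin m)) (cong f (toℕ-toFin m))

  at-cong : ∀ w {a b} → a ≈ b → at w a ≡ at w b
  at-cong w a≈b = cong (lookup w) (toFin-cong a≈b)

  lookup≡at : ∀ w i → lookup w i ≡ at w (toℕ i)
  lookup≡at w i = cong (lookup w) (sym (toFin-toℕ i))

  word-ext : ∀ {w w′} → (∀ m → at w m ≡ at w′ m) → w ≡ w′
  word-ext {w} {w′} at≗ = begin
    w
      ≡⟨ sym (Vecₚ.tabulate∘lookup w) ⟩
    Vec.tabulate (lookup w)
      ≡⟨ Vecₚ.tabulate-cong (λ i → trans (lookup≡at w i) (trans (at≗ (toℕ i)) (sym (lookup≡at w′ i)))) ⟩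
    Vec.tabulate (lookup w′)
      ≡⟨ Vecₚ.tabulate∘lookup w′ ⟩
    w′ ∎

  Dihedral : Set
  Dihedral = Fin n × Bool

  source : Bool → ℕ → ℕ → ℕ
  source false k j = j + k
  source true  k j = k + neg j

  source-cong : ∀ b {k k′ j j′} → k ≈ k′ → j ≈ j′ → source b k j ≈ source b k′ j′
  source-cong false k≈k′ j≈j′ = +-cong j≈j′ k≈k′
  source-cong true  k≈k′ j≈j′ = +-cong k≈k′ (neg-cong j≈j′)

  -- (k , false) rotates a word by k; (k , true) reads it backwards from k and complements it, since a
  -- reflection of the circle turns clockwise edges into counterclockwise ones.
  infixr 5 _▷_
  _▷_ : Dihedral → Word → Word
  (k , b) ▷ w = cyclic (λ j → b xor at w (source b (toℕ k) j))

  at-▷ : ∀ k b w m → at ((k , b) ▷ w) m ≡ b xor at w (source b (toℕ k) m)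
  at-▷ k b w m = trans (at-cyclic (λ j → b xor at w (source b (toℕ k) j)) m)
                       (cong (b xor_) (at-cong w (source-cong b ≈-refl (%-≈ m))))

  shift : ℕ → ℕ → Bool → ℕ
  shift k k′ false = k + k′
  shift k k′ true  = k′ + neg k

  _·_ : Dihedral → Dihedral → Dihedral
  (k , b) · (k′ , b′) = toFin (shift (toℕ k) (toℕ k′) b′) , b xor b′

  ε : Dihedral
  ε = toFin 0 , false

  _⁻¹ : Dihedral → Dihedral
  (k , false) ⁻¹ = toFin (neg (toℕ k)) , false
  (k , true)  ⁻¹ = k , true

  source-∘ : ∀ b b′ k k′ j → source b′ k′ (source b k j) ≈ source (b xor b′) (shift k k′ b′) j
  source-∘ false false k k′ j = ≡⇒≈ (+-assoc j k k′)
  source-∘ true  false k k′ j = ≡⇒≈ (+-CS.xy∙z≈xz∙y k (neg j) k′)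
  source-∘ false true  k k′ j = begin
    (k′ + neg (j + k)) % n       ≡⟨ +-congˡ k′ (neg-+ j k) ⟩
    (k′ + (neg j + neg k)) % n   ≡⟨ ≡⇒≈ (+-CS.x∙yz≈xy∙z k′ (neg j) (neg k)) ⟩
    (k′ + neg j + neg k) % n     ≡⟨ ≡⇒≈ (+-CS.xy∙z≈xz∙y k′ (neg j) (neg k)) ⟩
    (k′ + neg k + neg j) % n     ∎
  source-∘ true  true  k k′ j = begin
    (k′ + neg (k + neg j)) % n       ≡⟨ +-congˡ k′ (neg-+ k (neg j)) ⟩
    (k′ + (neg k + neg (neg j))) % n ≡⟨ +-congˡ k′ (+-congˡ (neg k) (neg-involutive j)) ⟩
    (k′ + (neg k + j)) % n           ≡⟨ ≡⇒≈ (+-CS.x∙yz≈zx∙y k′ (neg k) j) ⟩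
    (j + k′ + neg k) % n             ≡⟨ ≡⇒≈ (+-assoc j k′ (neg k)) ⟩
    (j + (k′ + neg k)) % n           ∎

  ·-▷ : ∀ g h w → g ▷ (h ▷ w) ≡ (g · h) ▷ w
  ·-▷ (k , b) (k′ , b′) w = word-ext λ m → begin
    at ((k , b) ▷ ((k′ , b′) ▷ w)) m
      ≡⟨ at-▷ k b ((k′ , b′) ▷ w) m ⟩
    b xor at ((k′ , b′) ▷ w) (source b (toℕ k) m)
      ≡⟨ cong (b xor_) (at-▷ k′ b′ w _) ⟩
    b xor (b′ xor at w (source b′ (toℕ k′) (source b (toℕ k) m)))
      ≡⟨ cong (λ z → b xor (b′ xor z)) (at-cong w (source-∘ b b′ _ _ m)) ⟩
    b xor (b′ xor at w (source (b xor b′) s m))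
      ≡⟨ sym (Boolₚ.xor-assoc b b′ _) ⟩
    (b xor b′) xor at w (source (b xor b′) s m)
      ≡⟨ cong ((b xor b′) xor_) (at-cong w (source-cong (b xor b′) (≈-sym (toℕ-toFin-≈ s)) ≈-refl)) ⟩
    (b xor b′) xor at w (source (b xor b′) (toℕ (toFin s)) m)
      ≡⟨ sym (at-▷ _ (b xor b′) w m) ⟩
    at (((k , b) · (k′ , b′)) ▷ w) m ∎
    where
    s = shift (toℕ k) (toℕ k′) b′

  ε-▷ : ∀ w → ε ▷ w ≡ w
  ε-▷ w = word-ext λ m → trans (at-▷ (toFin 0) false w m)
    (at-cong w (≈-trans (+-congˡ m (toℕ-toFin-≈ 0)) (≡⇒≈ (+-identityʳ m))))

  dihedral-≡ : ∀ {k k′ : Fin n} {b b′ : Bool} → toℕ k ≈ toℕ k′ → b ≡ b′ → (k , b) ≡ (k′ , b′)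
  dihedral-≡ k≈k′ refl = cong (_, _) (toℕ-injective-≈ k≈k′)

  private
    xor-cancelʳ : ∀ b c → (b xor c) xor c ≡ b
    xor-cancelʳ b c = trans (Boolₚ.xor-assoc b c c) (trans (cong (b xor_) (Boolₚ.xor-same c)) (Boolₚ.xor-identityʳ b))

  ⁻¹-· : ∀ g → (g ⁻¹) · g ≡ ε
  ⁻¹-· (k , false) = dihedral-≡ (begin
    toℕ (toFin (toℕ (toFin (neg (toℕ k))) + toℕ k)) % n ≡⟨ toℕ-toFin-≈ _ ⟩
    (toℕ (toFin (neg (toℕ k))) + toℕ k) % n           ≡⟨ +-congʳ (toℕ k) (toℕ-toFin-≈ _) ⟩
    (neg (toℕ k) + toℕ k) % n                          ≡⟨ +-inverseˡ (toℕ k) ⟩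
    0 % n                                              ≡⟨ ≈-sym (toℕ-toFin-≈ 0) ⟩
    toℕ (toFin 0) % n                                  ∎) refl
  ⁻¹-· (k , true) =
    dihedral-≡ (≈-trans (toℕ-toFin-≈ _) (≈-trans (+-inverseʳ (toℕ k)) (≈-sym (toℕ-toFin-≈ 0)))) refl

  ⁻¹-▷ : ∀ g w → (g ⁻¹) ▷ (g ▷ w) ≡ w
  ⁻¹-▷ g w = trans (·-▷ (g ⁻¹) g w) (trans (cong (_▷ w) (⁻¹-· g)) (ε-▷ w))

  ·-⁻¹-cancel : ∀ g h → (g · h) · (h ⁻¹) ≡ g
  ·-⁻¹-cancel (k , b) (k′ , false) = dihedral-≡ (begin
    toℕ (toFin (toℕ (toFin (toℕ k + toℕ k′)) + toℕ (toFin (neg (toℕ k′))))) % n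
      ≡⟨ toℕ-toFin-≈ _ ⟩
    (toℕ (toFin (toℕ k + toℕ k′)) + toℕ (toFin (neg (toℕ k′)))) % n
      ≡⟨ +-cong (toℕ-toFin-≈ _) (toℕ-toFin-≈ _) ⟩
    (toℕ k + toℕ k′ + neg (toℕ k′)) % n
      ≡⟨ m+n+neg[n]≈m (toℕ k) (toℕ k′) ⟩
    toℕ k % n                                                                    ∎) (xor-cancelʳ b false)
  ·-⁻¹-cancel (k , b) (k′ , true) = dihedral-≡ (begin
    toℕ (toFin (toℕ k′ + neg (toℕ (toFin (toℕ k′ + neg (toℕ k)))))) % n
      ≡⟨ toℕ-toFin-≈ _ ⟩
    (toℕ k′ + neg (toℕ (toFin (toℕ k′ + neg (toℕ k))))) % n
      ≡⟨ +-congˡ (toℕ k′) (neg-cong (toℕ-toFin-≈ _)) ⟩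
    (toℕ k′ + neg (toℕ k′ + neg (toℕ k))) % n
      ≡⟨ m+neg[m+neg[n]]≈n (toℕ k′) (toℕ k) ⟩
    toℕ k % n                                                          ∎) (xor-cancelʳ b true)

  ·-⁻¹-cancel′ : ∀ g h → (g · (h ⁻¹)) · h ≡ g
  ·-⁻¹-cancel′ (k , b) (k′ , false) = dihedral-≡ (begin
    toℕ (toFin (toℕ (toFin (toℕ k + toℕ (toFin (neg (toℕ k′))))) + toℕ k′)) % n
      ≡⟨ toℕ-toFin-≈ _ ⟩
    (toℕ (toFin (toℕ k + toℕ (toFin (neg (toℕ k′))))) + toℕ k′) % n
      ≡⟨ +-congʳ (toℕ k′) (toℕ-toFin-≈ _) ⟩
    (toℕ k + toℕ (toFin (neg (toℕ k′))) + toℕ k′) % n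
      ≡⟨ +-congʳ (toℕ k′) (+-congˡ (toℕ k) (toℕ-toFin-≈ _)) ⟩
    (toℕ k + neg (toℕ k′) + toℕ k′) % n
      ≡⟨ m+neg[n]+n≈m (toℕ k) (toℕ k′) ⟩
    toℕ k % n                                                                  ∎) (xor-cancelʳ b false)
  ·-⁻¹-cancel′ g (k′ , true) = ·-⁻¹-cancel g (k′ , true)

  ·-⁻¹ : ∀ g → g · (g ⁻¹) ≡ ε
  ·-⁻¹ (k , false) = dihedral-≡ (begin
    toℕ (toFin (toℕ k + toℕ (toFin (neg (toℕ k))))) % n ≡⟨ toℕ-toFin-≈ _ ⟩
    (toℕ k + toℕ (toFin (neg (toℕ k)))) % n            ≡⟨ +-congˡ (toℕ k) (toℕ-toFin-≈ _) ⟩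
    (toℕ k + neg (toℕ k)) % n                          ≡⟨ +-inverseʳ (toℕ k) ⟩
    0 % n                                              ≡⟨ ≈-sym (toℕ-toFin-≈ 0) ⟩
    toℕ (toFin 0) % n                                  ∎) refl
  ·-⁻¹ (k , true) = ⁻¹-· (k , true)

  ▷-⁻¹ : ∀ g w → g ▷ (g ⁻¹) ▷ w ≡ w
  ▷-⁻¹ g w = trans (·-▷ g (g ⁻¹) w) (trans (cong (_▷ w) (·-⁻¹ g)) (ε-▷ w))

  rotationBy1 : Dihedral
  rotationBy1 = toFin 1 , false

  reflection-conjugate : ∀ m → rotationBy1 · ((toFin (2 + m) , true) · (rotationBy1 ⁻¹)) ≡ (toFin m , true)
  reflection-conjugate m = dihedral-≡ (begin
    toℕ (toFin (toℕ (toFin (a + b)) + neg one)) % n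
      ≡⟨ toℕ-toFin-≈ _ ⟩
    (toℕ (toFin (a + b)) + neg one) % n
      ≡⟨ +-cong (toℕ-toFin-≈ (a + b)) (neg-cong one≈1) ⟩
    (a + b + neg 1) % n
      ≡⟨ +-congʳ (neg 1) (+-cong (toℕ-toFin-≈ (2 + m)) (≈-trans (toℕ-toFin-≈ _) (neg-cong one≈1))) ⟩
    (2 + m + neg 1 + neg 1) % n
      ≡⟨ +-congʳ (neg 1) (trans (≡⇒≈ (cong (_+ neg 1) (+-comm 1 (suc m)))) (m+n+neg[n]≈m (suc m) 1)) ⟩
    (suc m + neg 1) % n
      ≡⟨ ≡⇒≈ (cong (_+ neg 1) (+-comm 1 m)) ⟩
    (m + 1 + neg 1) % n
      ≡⟨ m+n+neg[n]≈m m 1 ⟩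
    m % n
      ≡⟨ ≈-sym (toℕ-toFin-≈ m) ⟩
    toℕ (toFin m) % n                              ∎) refl
    where
    one = toℕ (toFin 1)
    one≈1 : one ≈ 1
    one≈1 = toℕ-toFin-≈ 1
    a = toℕ (toFin (2 + m))
    b = toℕ (toFin (neg one))

  next : Fin n → Fin n
  next u = toFin (suc (toℕ u))

  Next⇒≡next : ∀ {u v : Fin n} → Next u v → v ≡ next u
  Next⇒≡next {u} {v} (inj₁ 1+u≡v)        = trans (sym (toFin-toℕ v)) (cong toFin (sym 1+u≡v))
  Next⇒≡next {u} {v} (inj₂ (1+u≡n , v≡0)) = Finₚ.toℕ-injective (begin
    toℕ v               ≡⟨ v≡0 ⟩
    0                   ≡⟨ sym (n%n≡0 n) ⟩
    n % n               ≡⟨ cong (_% n) (sym 1+u≡n) ⟩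
    suc (toℕ u) % n     ≡⟨ sym (toℕ-toFin _) ⟩
    toℕ (next u)        ∎)

  ≡next⇒Next : ∀ {u v : Fin n} → v ≡ next u → Next u v
  ≡next⇒Next {u} refl with suc (toℕ u) <? n
  ... | yes 1+u<n = inj₁ (sym (trans (toℕ-toFin _) (<⇒%-≡ 1+u<n)))
  ... | no 1+u≮n  = inj₂ (1+u≡n , trans (toℕ-toFin _) (trans (cong (_% n) 1+u≡n) (n%n≡0 n)))
    where
    1+u≡n : suc (toℕ u) ≡ n
    1+u≡n = ≤-antisym (Finₚ.toℕ<n u) (≮⇒≥ 1+u≮n)

  next-injective : Injective _≡_ _≡_ next
  next-injective {u} {v} eq = toℕ-injective-≈ (+-cancelʳ 1 (begin
    (toℕ u + 1) % n ≡⟨ ≡⇒≈ (+-comm (toℕ u) 1) ⟩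
    suc (toℕ u) % n ≡⟨ toFin-injective eq ⟩
    suc (toℕ v) % n ≡⟨ ≡⇒≈ (+-comm 1 (toℕ v)) ⟩
    (toℕ v + 1) % n ∎))

  next-toFin : ∀ m → next (toFin m) ≡ toFin (suc m)
  next-toFin m = toFin-cong (+-congˡ 1 (toℕ-toFin-≈ m))

  rotateVertex : ℕ → Fin n → Fin n
  rotateVertex k u = toFin (toℕ u + k)

  rotateVertex-neg : ∀ k u → rotateVertex (neg k) (rotateVertex k u) ≡ u
  rotateVertex-neg k u = toℕ-injective-≈ (begin
    toℕ (toFin (toℕ (toFin (toℕ u + k)) + neg k)) % n ≡⟨ toℕ-toFin-≈ _ ⟩
    (toℕ (toFin (toℕ u + k)) + neg k) % n            ≡⟨ +-congʳ (neg k) (toℕ-toFin-≈ _) ⟩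
    (toℕ u + k + neg k) % n                          ≡⟨ m+n+neg[n]≈m (toℕ u) k ⟩
    toℕ u % n                                        ∎)

  rotateVertex-neg′ : ∀ k u → rotateVertex k (rotateVertex (neg k) u) ≡ u
  rotateVertex-neg′ k u = toℕ-injective-≈ (begin
    toℕ (toFin (toℕ (toFin (toℕ u + neg k)) + k)) % n ≡⟨ toℕ-toFin-≈ _ ⟩
    (toℕ (toFin (toℕ u + neg k)) + k) % n            ≡⟨ +-congʳ k (toℕ-toFin-≈ _) ⟩
    (toℕ u + neg k + k) % n                          ≡⟨ m+neg[n]+n≈m (toℕ u) k ⟩
    toℕ u % n                                        ∎)

  rotateVertex-next : ∀ k u → rotateVertex k (next u) ≡ next (rotateVertex k u)
  rotateVertex-next k u = toℕ-injective-≈ (begin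
    toℕ (toFin (toℕ (next u) + k)) % n  ≡⟨ toℕ-toFin-≈ _ ⟩
    (toℕ (next u) + k) % n             ≡⟨ +-congʳ k (toℕ-toFin-≈ _) ⟩
    suc (toℕ u + k) % n                ≡⟨ +-congˡ 1 (≈-sym (toℕ-toFin-≈ _)) ⟩
    suc (toℕ (rotateVertex k u)) % n   ≡⟨ ≈-sym (toℕ-toFin-≈ _) ⟩
    toℕ (next (rotateVertex k u)) % n  ∎)

  reflectVertex : ℕ → Fin n → Fin n
  reflectVertex k u = toFin (k + neg (toℕ u))

  toℕ-reflectVertex-≈ : ∀ k u → toℕ (reflectVertex k u) ≈ k + neg (toℕ u)
  toℕ-reflectVertex-≈ k u = toℕ-toFin-≈ _

  reflectVertex-involutive : ∀ k u → reflectVertex k (reflectVertex k u) ≡ u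
  reflectVertex-involutive k u = toℕ-injective-≈ (begin
    toℕ (reflectVertex k (reflectVertex k u)) % n ≡⟨ toℕ-reflectVertex-≈ k _ ⟩
    (k + neg (toℕ (reflectVertex k u))) % n     ≡⟨ +-congˡ k (neg-cong (toℕ-reflectVertex-≈ k u)) ⟩
    (k + neg (k + neg (toℕ u))) % n             ≡⟨ m+neg[m+neg[n]]≈n k (toℕ u) ⟩
    toℕ u % n                                   ∎)

  toℕ-reflectVertex-next-≈ : ∀ k u → toℕ (reflectVertex (suc k) (next u)) ≈ k + neg (toℕ u)
  toℕ-reflectVertex-next-≈ k u = begin
    toℕ (reflectVertex (suc k) (next u)) % n ≡⟨ toℕ-reflectVertex-≈ (suc k) (next u) ⟩
    (suc k + neg (toℕ (next u))) % n         ≡⟨ +-congˡ (suc k) (neg-cong (toℕ-toFin-≈ _)) ⟩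
    (suc k + neg (suc (toℕ u))) % n          ≡⟨ 1+m+neg[1+n]≈m+neg[n] k (toℕ u) ⟩
    (k + neg (toℕ u)) % n                    ∎

  next-reflectVertex-next : ∀ k u → next (reflectVertex (suc k) (next u)) ≡ reflectVertex (suc k) u
  next-reflectVertex-next k u = toℕ-injective-≈ (begin
    toℕ (next (reflectVertex (suc k) (next u))) % n ≡⟨ toℕ-toFin-≈ _ ⟩
    suc (toℕ (reflectVertex (suc k) (next u))) % n  ≡⟨ +-congˡ 1 (toℕ-reflectVertex-next-≈ k u) ⟩
    (suc k + neg (toℕ u)) % n                       ≡⟨ ≈-sym (toℕ-reflectVertex-≈ (suc k) u) ⟩
    toℕ (reflectVertex (suc k) u) % n               ∎)

module CycleIsomorphisms (n : ℕ) .{{_ : NonZero n}} (3≤n : 3 ≤ n) where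
  open DihedralAction n public

  u≢next[next[u]] : ∀ u → u ≢ next (next u)
  u≢next[next[u]] u eq = contradiction 2≡0 λ ()
    where
    2+u≈u : 2 + toℕ u ≈ 0 + toℕ u
    2+u≈u = begin
      suc (suc (toℕ u)) % n   ≡⟨ +-congˡ 1 (≈-sym (toℕ-toFin-≈ _)) ⟩
      suc (toℕ (next u)) % n  ≡⟨ ≈-sym (toℕ-toFin-≈ _) ⟩
      toℕ (next (next u)) % n ≡⟨ cong (λ z → toℕ z % n) (sym eq) ⟩
      toℕ u % n               ∎
    2≡0 : 2 ≡ 0
    2≡0 = trans (sym (<⇒%-≡ 3≤n)) (trans (+-cancelʳ (toℕ u) 2+u≈u) (<⇒%-≡ (>-nonZero⁻¹ n)))

  data CyclicArc (o : Fin n → Bool) (u v : Fin n) : Set where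
    forward  : v ≡ next u → o u ≡ true  → CyclicArc o u v
    backward : u ≡ next v → o v ≡ false → CyclicArc o u v

  Arc⇒CyclicArc : ∀ {o u v} → Arc o u v → CyclicArc o u v
  Arc⇒CyclicArc (inj₁ (u→v , ou)) = forward (Next⇒≡next u→v) ou
  Arc⇒CyclicArc (inj₂ (v→u , ov)) = backward (Next⇒≡next v→u) ov

  CyclicArc⇒Arc : ∀ {o u v} → CyclicArc o u v → Arc o u v
  CyclicArc⇒Arc (forward v≡u⁺ ou)  = inj₁ (≡next⇒Next v≡u⁺ , ou)
  CyclicArc⇒Arc (backward u≡v⁺ ov) = inj₂ (≡next⇒Next u≡v⁺ , ov)

  ArcsPreserved : (o o′ : Fin n → Bool) → (Fin n → Fin n) → Set
  ArcsPreserved o o′ f = ∀ u v → Arc o u v ⇔ Arc o′ (f u) (f v)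

  cyclicArcsPreserved : ∀ {o o′ f} →
    (∀ {u v} → CyclicArc o u v → CyclicArc o′ (f u) (f v)) →
    (∀ {u v} → CyclicArc o′ (f u) (f v) → CyclicArc o u v) → ArcsPreserved o o′ f
  cyclicArcsPreserved to from u v =
    mk⇔ (CyclicArc⇒Arc ∘ to ∘ Arc⇒CyclicArc) (CyclicArc⇒Arc ∘ from ∘ Arc⇒CyclicArc)

  rotation-preservesArcs : ∀ {o o′ f} → Injective _≡_ _≡_ f →
    (∀ u → f (next u) ≡ next (f u)) → (∀ u → o u ≡ o′ (f u)) → ArcsPreserved o o′ f
  rotation-preservesArcs {o} {o′} {f} f-inj f∘next o≗o′∘f = cyclicArcsPreserved to from
    where
    to : ∀ {u v} → CyclicArc o u v → CyclicArc o′ (f u) (f v)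
    to {u}     (forward refl ou)  = forward (f∘next u) (trans (sym (o≗o′∘f u)) ou)
    to {v = v} (backward refl ov) = backward (f∘next v) (trans (sym (o≗o′∘f v)) ov)
    from : ∀ {u v} → CyclicArc o′ (f u) (f v) → CyclicArc o u v
    from {u}     (forward fv≡fu⁺ o′fu)  = forward (f-inj (trans fv≡fu⁺ (sym (f∘next u)))) (trans (o≗o′∘f u) o′fu)
    from {v = v} (backward fu≡fv⁺ o′fv) = backward (f-inj (trans fu≡fv⁺ (sym (f∘next v)))) (trans (o≗o′∘f v) o′fv)

  reversal-preservesArcs : ∀ {o o′ f} → Injective _≡_ _≡_ f →
    (∀ u → next (f (next u)) ≡ f u) → (∀ u → o u ≡ not (o′ (f (next u)))) → ArcsPreserved o o′ f
  reversal-preservesArcs {o} {o′} {f} f-inj f-reverses o≗not∘o′∘f∘next = cyclicArcsPreserved to from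
    where
    to : ∀ {u v} → CyclicArc o u v → CyclicArc o′ (f u) (f v)
    to {u}     (forward refl ou)  = backward (sym (f-reverses u)) (Boolₚ.not-injective (trans (sym (o≗not∘o′∘f∘next u)) ou))
    to {v = v} (backward refl ov) = forward (sym (f-reverses v)) (Boolₚ.not-injective (trans (sym (o≗not∘o′∘f∘next v)) ov))
    from : ∀ {u v} → CyclicArc o′ (f u) (f v) → CyclicArc o u v
    from {u} {v} (forward fv≡fu⁺ o′fu) =
      backward (sym v⁺≡u) (trans (o≗not∘o′∘f∘next v) (trans (cong (not ∘ o′ ∘ f) v⁺≡u) (cong not o′fu)))
      where
      v⁺≡u : next v ≡ u
      v⁺≡u = f-inj (next-injective (trans (f-reverses v) fv≡fu⁺))
    from {u} {v} (backward fu≡fv⁺ o′fv) =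
      forward (sym u⁺≡v) (trans (o≗not∘o′∘f∘next u) (trans (cong (not ∘ o′ ∘ f) u⁺≡v) (cong not o′fv)))
      where
      u⁺≡v : next u ≡ v
      u⁺≡v = f-inj (next-injective (trans (f-reverses u) fu≡fv⁺))

  ▷-Iso : ∀ g w → Iso (lookup (g ▷ w)) (lookup w)
  ▷-Iso (k , false) w =
    mk↔ₛ′ (rotateVertex (toℕ k)) (rotateVertex (neg (toℕ k))) (rotateVertex-neg′ (toℕ k)) (rotateVertex-neg (toℕ k)) ,
    rotation-preservesArcs {o′ = lookup w}
      (retraction⇒injective (rotateVertex (neg (toℕ k))) (rotateVertex-neg (toℕ k))) (rotateVertex-next (toℕ k))
      (λ u → trans (lookup≡at ((k , false) ▷ w) u) (at-▷ k false w (toℕ u)))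
  -- The edge map j ↦ k − j comes from the vertex map u ↦ k + 1 − u.
  ▷-Iso (k , true) w =
    mk↔ₛ′ (reflectVertex (suc (toℕ k))) (reflectVertex (suc (toℕ k)))
      (reflectVertex-involutive (suc (toℕ k))) (reflectVertex-involutive (suc (toℕ k))) ,
    reversal-preservesArcs {o′ = lookup w}
      (retraction⇒injective (reflectVertex (suc (toℕ k))) (reflectVertex-involutive (suc (toℕ k))))
      (next-reflectVertex-next (toℕ k)) colours
    where
    colours : ∀ u → lookup ((k , true) ▷ w) u ≡ not (lookup w (reflectVertex (suc (toℕ k)) (next u)))
    colours u = begin
      lookup ((k , true) ▷ w) u
        ≡⟨ lookup≡at ((k , true) ▷ w) u ⟩
      at ((k , true) ▷ w) (toℕ u)
        ≡⟨ at-▷ k true w (toℕ u) ⟩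
      not (at w (toℕ k + neg (toℕ u)))
        ≡⟨ cong not (at-cong w (≈-sym (toℕ-reflectVertex-next-≈ (toℕ k) u))) ⟩
      not (at w (toℕ (reflectVertex (suc (toℕ k)) (next u))))
        ≡⟨ cong not (sym (lookup≡at w _)) ⟩
      not (lookup w (reflectVertex (suc (toℕ k)) (next u))) ∎

  forwardArc : ∀ o {u} → o u ≡ true → Arc o u (next u)
  forwardArc o ou = CyclicArc⇒Arc {o} (forward refl ou)

  backwardArc : ∀ o {u} → o u ≡ false → Arc o (next u) u
  backwardArc o ou = CyclicArc⇒Arc {o} (backward refl ou)

  forwardArc⁻¹ : ∀ o {u} → Arc o u (next u) → o u ≡ true
  forwardArc⁻¹ o {u} arc with Arc⇒CyclicArc {o} arc
  ... | forward _ ou     = ou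
  ... | backward u≡u⁺⁺ _ = ⊥-elim (u≢next[next[u]] u u≡u⁺⁺)

  backwardArc⁻¹ : ∀ o {u} → Arc o (next u) u → o u ≡ false
  backwardArc⁻¹ o {u} arc with Arc⇒CyclicArc {o} arc
  ... | forward u≡u⁺⁺ _ = ⊥-elim (u≢next[next[u]] u u≡u⁺⁺)
  ... | backward _ ou   = ou

  Arc⇒adjacent : ∀ o {u v} → Arc o u v → v ≡ next u ⊎ u ≡ next v
  Arc⇒adjacent o arc with Arc⇒CyclicArc {o} arc
  ... | forward v≡u⁺ _  = inj₁ v≡u⁺
  ... | backward u≡v⁺ _ = inj₂ u≡v⁺

  -- As n ≥ 3, the two neighbours of a vertex differ, so an arc-preserving bijection commutes with next
  -- everywhere or reverses it everywhere; either way it is determined by the image of 0.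
  module ArcsPreserved⇒Affine {o o′ : Fin n → Bool} {f : Fin n → Fin n}
    (f-inj : Injective _≡_ _≡_ f) (arcs : ArcsPreserved o o′ f) where

    private
      image : ∀ {u v} → Arc o u v → Arc o′ (f u) (f v)
      image {u} {v} = Equivalence.to (arcs u v)

      preimage : ∀ {u v} → Arc o′ (f u) (f v) → Arc o u v
      preimage {u} {v} = Equivalence.from (arcs u v)

    adjacent : ∀ u → f (next u) ≡ next (f u) ⊎ f u ≡ next (f (next u))
    adjacent u with o u in ou
    ... | true  = Arc⇒adjacent o′ (image (forwardArc o ou))
    ... | false = Sum.swap (Arc⇒adjacent o′ (image (backwardArc o ou)))

    keeps-orientation : ∀ u → f (next u) ≡ next (f u) → f (next (next u)) ≡ next (f (next u))
    keeps-orientation u fu⁺≡fu⁺ with adjacent (next u)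
    ... | inj₁ eq = eq
    ... | inj₂ eq = ⊥-elim (u≢next[next[u]] u (f-inj (next-injective (trans (sym fu⁺≡fu⁺) eq))))

    keeps-reversal : ∀ u → f u ≡ next (f (next u)) → f (next u) ≡ next (f (next (next u)))
    keeps-reversal u fu≡fu⁺⁺ with adjacent (next u)
    ... | inj₁ eq = ⊥-elim (u≢next[next[u]] u (f-inj (trans fu≡fu⁺⁺ (sym eq))))
    ... | inj₂ eq = eq

    origin : Fin n
    origin = toFin 0

    Rotating Reversing : Set
    Rotating  = f (next origin) ≡ next (f origin)
    Reversing = f origin ≡ next (f (next origin))

    α : ℕ
    α = toℕ (f origin)

    f-origin : f origin ≡ toFin α
    f-origin = sym (toFin-toℕ (f origin))

    rotates-from : ∀ m → Rotating → f (next (toFin m)) ≡ next (f (toFin m))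
    rotates-from zero    start = start
    rotates-from (suc m) start =
      subst (λ u → f (next u) ≡ next (f u)) (next-toFin m) (keeps-orientation (toFin m) (rotates-from m start))

    reverses-from : ∀ m → Reversing → f (toFin m) ≡ next (f (next (toFin m)))
    reverses-from zero    start = start
    reverses-from (suc m) start =
      subst (λ u → f u ≡ next (f (next u))) (next-toFin m) (keeps-reversal (toFin m) (reverses-from m start))

    rotation-formula : Rotating → ∀ m → f (toFin m) ≡ toFin (α + m)
    rotation-formula start zero    = trans f-origin (cong toFin (sym (+-identityʳ α)))
    rotation-formula start (suc m) = begin
      f (toFin (suc m))     ≡⟨ cong f (sym (next-toFin m)) ⟩
      f (next (toFin m))    ≡⟨ rotates-from m start ⟩
      next (f (toFin m))    ≡⟨ cong next (rotation-formula start m) ⟩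
      next (toFin (α + m))  ≡⟨ next-toFin (α + m) ⟩
      toFin (suc (α + m))   ≡⟨ cong toFin (sym (+-suc α m)) ⟩
      toFin (α + suc m)     ∎

    reflection-formula : Reversing → ∀ m → f (toFin m) ≡ toFin (α + neg m)
    reflection-formula start zero    = trans f-origin (toFin-cong (≈-sym (begin
      (α + neg 0) % n   ≡⟨ ≡⇒≈ (cong (λ z → α + (n ∸ z)) (<⇒%-≡ (>-nonZero⁻¹ n))) ⟩
      (α + (n ∸ 0)) % n ≡⟨ +n≈ α ⟩
      α % n             ∎)))
    reflection-formula start (suc m) = next-injective (begin
      next (f (toFin (suc m)))      ≡⟨ cong (next ∘ f) (sym (next-toFin m)) ⟩
      next (f (next (toFin m)))     ≡⟨ sym (reverses-from m start) ⟩
      f (toFin m)                   ≡⟨ reflection-formula start m ⟩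
      toFin (α + neg m)             ≡⟨ toFin-cong (≈-sym (1+m+neg[1+n]≈m+neg[n] α m)) ⟩
      toFin (suc (α + neg (suc m))) ≡⟨ sym (next-toFin _) ⟩
      next (toFin (α + neg (suc m))) ∎)

    colours-along : (∀ u → f (next u) ≡ next (f u)) → ∀ u → o u ≡ o′ (f u)
    colours-along rotates u = Boolₚ.⇔→≡ {z = true} (mk⇔
      (λ ou → forwardArc⁻¹ o′ (subst (Arc o′ (f u)) (rotates u) (image (forwardArc o ou))))
      (λ o′fu → forwardArc⁻¹ o (preimage (subst (Arc o′ (f u)) (sym (rotates u)) (forwardArc o′ o′fu)))))

    colours-across : (∀ u → f u ≡ next (f (next u))) → ∀ u → o u ≡ not (o′ (f (next u)))
    colours-across reverses u = Boolₚ.⇔→≡ {z = true} (mk⇔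
      (λ ou → cong not (backwardArc⁻¹ o′ (subst (λ x → Arc o′ x (f (next u))) (reverses u) (image (forwardArc o ou)))))
      (λ not-o′ → forwardArc⁻¹ o (preimage (subst (λ x → Arc o′ x (f (next u))) (sym (reverses u))
                     (backwardArc o′ (Boolₚ.not-injective not-o′))))))

    rotation-colours : Rotating → ∀ m → o (toFin m) ≡ o′ (toFin (α + m))
    rotation-colours start m = trans (colours-along rotates (toFin m)) (cong o′ (rotation-formula start m))
      where
      rotates : ∀ u → f (next u) ≡ next (f u)
      rotates u = subst (λ v → f (next v) ≡ next (f v)) (toFin-toℕ u) (rotates-from (toℕ u) start)

    reflection-colours : Reversing → ∀ m → o (toFin m) ≡ not (o′ (toFin (α + neg (suc m))))
    reflection-colours start m = begin
      o (toFin m)                              ≡⟨ colours-across reverses (toFin m) ⟩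
      not (o′ (f (next (toFin m))))            ≡⟨ cong (not ∘ o′ ∘ f) (next-toFin m) ⟩
      not (o′ (f (toFin (suc m))))             ≡⟨ cong (not ∘ o′) (reflection-formula start (suc m)) ⟩
      not (o′ (toFin (α + neg (suc m))))       ∎
      where
      reverses : ∀ u → f u ≡ next (f (next u))
      reverses u = subst (λ v → f v ≡ next (f (next v))) (toFin-toℕ u) (reverses-from (toℕ u) start)

  Iso⇒∼ : ∀ r s → Iso (lookup r) (lookup s) → ∃ λ g → g ▷ r ≡ s
  Iso⇒∼ r s (F , arcs) = [ rotation , reflection ]′ (A.adjacent A.origin)
    where
    module A = ArcsPreserved⇒Affine {lookup r} {lookup s}
                 (retraction⇒injective (Inverse.from F) (Inverse.strictlyInverseʳ F)) arcs
    open A using (α)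

    rotation : A.Rotating → ∃ λ g → g ▷ r ≡ s
    rotation start = (k , false) , word-ext λ j → begin
      at ((k , false) ▷ r) j      ≡⟨ at-▷ k false r j ⟩
      at r (j + toℕ k)            ≡⟨ A.rotation-colours start (j + toℕ k) ⟩
      at s (α + (j + toℕ k))      ≡⟨ at-cong s (α+[j+k]≈j j) ⟩
      at s j                      ∎
      where
      k = toFin (neg α)
      α+[j+k]≈j : ∀ j → α + (j + toℕ k) ≈ j
      α+[j+k]≈j j = begin
        (α + (j + toℕ k)) % n     ≡⟨ +-congˡ α (+-congˡ j (toℕ-toFin-≈ (neg α))) ⟩
        (α + (j + neg α)) % n     ≡⟨ ≡⇒≈ (+-CS.x∙yz≈y∙xz α j (neg α)) ⟩
        (j + (α + neg α)) % n     ≡⟨ +-congˡ j (+-inverseʳ α) ⟩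
        (j + 0) % n               ≡⟨ ≡⇒≈ (+-identityʳ j) ⟩
        j % n                     ∎

    reflection : A.Reversing → ∃ λ g → g ▷ r ≡ s
    reflection start = (k , true) , word-ext λ j → begin
      at ((k , true) ▷ r) j                          ≡⟨ at-▷ k true r j ⟩
      not (at r (toℕ k + neg j))                     ≡⟨ cong not (A.reflection-colours start (toℕ k + neg j)) ⟩
      not (not (at s (α + neg (suc (toℕ k + neg j))))) ≡⟨ Boolₚ.not-involutive _ ⟩
      at s (α + neg (suc (toℕ k + neg j)))           ≡⟨ at-cong s (α-[1+k-j]≈j j) ⟩
      at s j                                         ∎
      where
      k = toFin (α + neg 1)
      1+k≈α : suc (toℕ k) ≈ α
      1+k≈α = begin
        suc (toℕ k) % n       ≡⟨ +-congˡ 1 (toℕ-toFin-≈ (α + neg 1)) ⟩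
        suc (α + neg 1) % n   ≡⟨ ≡⇒≈ (+-comm 1 (α + neg 1)) ⟩
        (α + neg 1 + 1) % n   ≡⟨ m+neg[n]+n≈m α 1 ⟩
        α % n                 ∎
      α-[1+k-j]≈j : ∀ j → α + neg (suc (toℕ k + neg j)) ≈ j
      α-[1+k-j]≈j j = begin
        (α + neg (suc (toℕ k) + neg j)) % n ≡⟨ +-congˡ α (neg-cong (+-congʳ (neg j) 1+k≈α)) ⟩
        (α + neg (α + neg j)) % n           ≡⟨ m+neg[m+neg[n]]≈n α j ⟩
        j % n                               ∎

-- Counting fixed words

module GcdClasses (n : ℕ) .{{_ : NonZero n}} where
  open Modular n

  gcdWith : Fin n → ℕ
  gcdWith k = gcd (toℕ k) n

  gcdWith-nonZero : ∀ k → NonZero (gcdWith k)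
  gcdWith-nonZero k = ≢-nonZero (gcd[m,n]≢0 (toℕ k) n (inj₂ (≢-nonZero⁻¹ n)))

  classSize : ℕ → ℕ
  classSize e = ∑[ k ∈ allFin n ] δℕ (e * gcdWith k) n

  classSize-∤ : ∀ e → ¬ e ∣ n → classSize e ≡ 0
  classSize-∤ e e∤n = trans (∑-cong (allFin n) vanishes) (∑-zero (allFin n))
    where
    vanishes : ∀ k → δℕ (e * gcdWith k) n ≡ 0
    vanishes k = δℕ-≢ λ e*g≡n → e∤n (divides (gcdWith k) (trans (sym e*g≡n) (*-comm e _)))

  module _ (e : ℕ) .{{_ : NonZero e}} (e∣n : e ∣ n) where
    private
      c : ℕ
      c = n / e

      n≡c*e : n ≡ c * e
      n≡c*e = sym (m/n*n≡m e∣n)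

      instance
        c-nonZero : NonZero c
        c-nonZero = quotient-nonZero n e e∣n

      multiple : Fin e → Fin n
      multiple j = toFin (c * toℕ j)

      toℕ-multiple : ∀ j → toℕ (multiple j) ≡ c * toℕ j
      toℕ-multiple j = trans (toℕ-toFin _) (<⇒%-≡ (subst (c * toℕ j <_) (sym n≡c*e) (*-monoʳ-< c (Finₚ.toℕ<n j))))

      multiple-injective : Injective _≡_ _≡_ multiple
      multiple-injective {u} {v} eq =
        Finₚ.toℕ-injective (*-cancelˡ-≡ (toℕ u) (toℕ v) c
          (trans (sym (toℕ-multiple u)) (trans (cong toℕ eq) (toℕ-multiple v))))

      indicator-multiple : ∀ j → δℕ (e * gcdWith (multiple j)) n ≡ δℕ (gcd (toℕ j) e) 1
      indicator-multiple j = begin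
        δℕ (e * gcd (toℕ (multiple j)) n) n
          ≡⟨ cong₂ (λ a b → δℕ (e * gcd a b) b) (toℕ-multiple j) n≡c*e ⟩
        δℕ (e * gcd (c * toℕ j) (c * e)) (c * e)
          ≡⟨ cong₂ (λ a b → δℕ (e * a) b) (sym (c*gcd[m,n]≡gcd[cm,cn] c (toℕ j) e)) (sym (*-identityʳ (c * e))) ⟩
        δℕ (e * (c * gcd (toℕ j) e)) (c * e * 1)
          ≡⟨ cong (λ a → δℕ a (c * e * 1)) (*-CS.x∙yz≈yx∙z e c _) ⟩
        δℕ (c * e * gcd (toℕ j) e) (c * e * 1)
          ≡⟨ δ-injective _≟_ _≟_ (c * e *_) (*-cancelˡ-≡ _ _ (c * e) {{m*n≢0 c e}}) (gcd (toℕ j) e) 1 ⟩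
        δℕ (gcd (toℕ j) e) 1 ∎

      support-multiples : ∀ k → 0 < δℕ (e * gcdWith k) n → ∃ λ j → multiple j ≡ k
      support-multiples k 0<δ = fromℕ< q<e , Finₚ.toℕ-injective (begin
        toℕ (multiple (fromℕ< q<e)) ≡⟨ toℕ-multiple _ ⟩
        c * toℕ (fromℕ< q<e)        ≡⟨ cong (c *_) (Finₚ.toℕ-fromℕ< q<e) ⟩
        c * q                       ≡⟨ *-comm c q ⟩
        q * c                       ≡⟨ sym k≡q*c ⟩
        toℕ k                       ∎)
        where
        gcd≡c : gcdWith k ≡ c
        gcd≡c = *-cancelˡ-≡ (gcdWith k) c e (trans (δℕ-positive 0<δ) (trans n≡c*e (*-comm c e)))
        c∣k : c ∣ toℕ k
        c∣k = subst (_∣ toℕ k) gcd≡c (gcd[m,n]∣m (toℕ k) n)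
        q = _∣_.quotient c∣k
        k≡q*c : toℕ k ≡ q * c
        k≡q*c = _∣_.equality c∣k
        q<e : q < e
        q<e = *-cancelʳ-< c q e (subst₂ _<_ k≡q*c (trans n≡c*e (*-comm c e)) (Finₚ.toℕ<n k))

    classSize-∣ : classSize e ≡ φ e
    classSize-∣ = begin
      classSize e
        ≡⟨ sym (∑-reindex Finₚ._≟_ Finₚ._≟_ (allFin-enumerates n) (allFin-enumerates e)
                 multiple multiple-injective _ support-multiples) ⟩
      ∑[ j ∈ allFin e ] δℕ (e * gcdWith (multiple j)) n
        ≡⟨ ∑-cong (allFin e) indicator-multiple ⟩
      ∑[ j ∈ allFin e ] δℕ (gcd (toℕ j) e) 1
        ≡⟨ sym (∑<≡∑allFin e _) ⟩
      ∑[ j < e ] δℕ (gcd j e) 1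
        ≡⟨ sym (φ≡∑< e) ⟩
      φ e
        ∎

  gcd-as-∑< : ∀ (H : ℕ → ℕ) k → H (gcdWith k) ≡ ∑[ i < n ] (δℕ (suc i * gcdWith k) n * H (n / suc i))
  gcd-as-∑< H k = sym (begin
    ∑[ i < n ] (δℕ (suc i * g) n * H (n / suc i))  ≡⟨ ∑-cong (upTo n) (λ i → cong (_* H (n / suc i)) (δ-shift i)) ⟩
    ∑[ i < n ] (δℕ i c′ * H (n / suc i))           ≡⟨ ∑<-δ n c′ (λ i → H (n / suc i)) c′<n ⟩
    H (n / suc c′)                                 ≡⟨ cong H n/[1+c′]≡g ⟩
    H g                                            ∎)
    where
    g = gcdWith k
    g∣n : g ∣ n
    g∣n = gcd[m,n]∣n (toℕ k) n
    instance
      g-nonZero : NonZero g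
      g-nonZero = gcdWith-nonZero k
      n/g-nonZero : NonZero (n / g)
      n/g-nonZero = quotient-nonZero n g g∣n
    c′ = pred (n / g)
    n/g≡1+c′ : n / g ≡ suc c′
    n/g≡1+c′ = sym (suc-pred (n / g))
    c′<n : c′ < n
    c′<n = subst (_≤ n) n/g≡1+c′ (m/n≤m n g)
    δ-shift : ∀ i → δℕ (suc i * g) n ≡ δℕ i c′
    δ-shift i = begin
      δℕ (suc i * g) n             ≡⟨ cong (δℕ (suc i * g)) (trans (sym (m/n*n≡m g∣n)) (cong (_* g) n/g≡1+c′)) ⟩
      δℕ (suc i * g) (suc c′ * g)  ≡⟨ δ-injective _≟_ _≟_ (_* g) (*-cancelʳ-≡ _ _ g) (suc i) (suc c′) ⟩
      δℕ (suc i) (suc c′)          ≡⟨ δℕ-suc i c′ ⟩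
      δℕ i c′                      ∎
    n/[1+c′]≡g : n / suc c′ ≡ g
    n/[1+c′]≡g = trans (/-congʳ (sym n/g≡1+c′)) (n/[n/d]≡d n g g∣n)

  ∑-gcdWith : ∀ (H : ℕ → ℕ) → ∑[ k ∈ allFin n ] H (gcdWith k) ≡ ∑[ i < n ] (classSize (suc i) * H (n / suc i))
  ∑-gcdWith H = begin
    ∑[ k ∈ allFin n ] H (gcdWith k)
      ≡⟨ ∑-cong (allFin n) (gcd-as-∑< H) ⟩
    ∑[ k ∈ allFin n ] ∑[ i < n ] (δℕ (suc i * gcdWith k) n * H (n / suc i))
      ≡⟨ ∑-swap (allFin n) (upTo n) _ ⟩
    ∑[ i < n ] ∑[ k ∈ allFin n ] (δℕ (suc i * gcdWith k) n * H (n / suc i))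
      ≡⟨ ∑-cong (upTo n) (λ i → ∑-*ʳ (allFin n) (H (n / suc i)) _) ⟩
    ∑[ i < n ] (classSize (suc i) * H (n / suc i)) ∎

module Counting (n : ℕ) .{{_ : NonZero n}} where
  open DihedralAction n
  open GcdClasses n

  δW : Word → Word → ℕ
  δW = Kronecker.δ _≟W_

  ones≡∑ : ∀ (w : Word) → ones w ≡ ∑[ i ∈ allFin n ] bit (lookup w i)
  ones≡∑ w = countTrue≡∑ n (lookup w)

  ones≡∑< : ∀ (w : Word) → ones w ≡ ∑[ i < n ] bit (at w i)
  ones≡∑< w = begin
    ones w                                      ≡⟨ ones≡∑ w ⟩
    ∑[ i ∈ allFin n ] bit (lookup w i)          ≡⟨ ∑-cong (allFin n) (λ i → cong bit (lookup≡at w i)) ⟩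
    ∑[ i ∈ allFin n ] bit (at w (toℕ i))        ≡⟨ sym (∑<≡∑allFin n _) ⟩
    ∑[ i < n ] bit (at w i)                     ∎

  zeros≡∑ : ∀ (w : Word) → zeros w ≡ ∑[ i ∈ allFin n ] bit (not (lookup w i))
  zeros≡∑ w = countFalse≡∑ n (lookup w)

  ones+zeros≡n : ∀ (w : Word) → ones w + zeros w ≡ n
  ones+zeros≡n w = begin
    ones w + zeros w
      ≡⟨ cong₂ _+_ (ones≡∑ w) (zeros≡∑ w) ⟩
    ∑[ i ∈ allFin n ] bit (lookup w i) + ∑[ i ∈ allFin n ] bit (not (lookup w i))
      ≡⟨ sym (∑-+ (allFin n) _ _) ⟩
    ∑[ i ∈ allFin n ] (bit (lookup w i) + bit (not (lookup w i)))
      ≡⟨ ∑-cong (allFin n) (λ i → bit+bit-not (lookup w i)) ⟩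
    ∑[ i ∈ allFin n ] 1
      ≡⟨ ∑-const (allFin n) 1 ⟩
    length (allFin n) * 1
      ≡⟨ *-identityʳ _ ⟩
    length (allFin n)
      ≡⟨ length-tabulate id ⟩
    n ∎
    where
    bit+bit-not : ∀ b → bit b + bit (not b) ≡ 1
    bit+bit-not true  = refl
    bit+bit-not false = refl

  ones≤n : ∀ w → ones w ≤ n
  ones≤n w = subst (ones w ≤_) (ones+zeros≡n w) (m≤m+n _ _)

  zeros≡n∸ones : ∀ w → zeros w ≡ n ∸ ones w
  zeros≡n∸ones w = sym (trans (cong (_∸ ones w) (sym (ones+zeros≡n w))) (m+n∸m≡n (ones w) (zeros w)))

  private
    ∑-rotateVertex : ∀ k (h : Fin n → ℕ) → ∑[ i ∈ allFin n ] h (rotateVertex k i) ≡ ∑ (allFin n) h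
    ∑-rotateVertex k = ∑-permute Finₚ._≟_ (allFin-enumerates n) (rotateVertex k) (rotateVertex (neg k))
                         (rotateVertex-neg′ k) (rotateVertex-neg k)

    ∑-reflectVertex : ∀ k (h : Fin n → ℕ) → ∑[ i ∈ allFin n ] h (reflectVertex k i) ≡ ∑ (allFin n) h
    ∑-reflectVertex k = ∑-permute Finₚ._≟_ (allFin-enumerates n) (reflectVertex k) (reflectVertex k)
                          (reflectVertex-involutive k) (reflectVertex-involutive k)

    lookup-rotation : ∀ k w i → lookup ((k , false) ▷ w) i ≡ lookup w (rotateVertex (toℕ k) i)
    lookup-rotation k w i = trans (lookup≡at ((k , false) ▷ w) i) (at-▷ k false w (toℕ i))

    lookup-reflection : ∀ k w i → lookup ((k , true) ▷ w) i ≡ not (lookup w (reflectVertex (toℕ k) i))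
    lookup-reflection k w i = trans (lookup≡at ((k , true) ▷ w) i) (at-▷ k true w (toℕ i))

  ones-rotation : ∀ k w → ones ((k , false) ▷ w) ≡ ones w
  ones-rotation k w = begin
    ones ((k , false) ▷ w)
      ≡⟨ ones≡∑ ((k , false) ▷ w) ⟩
    ∑[ i ∈ allFin n ] bit (lookup ((k , false) ▷ w) i)
      ≡⟨ ∑-cong (allFin n) (λ i → cong bit (lookup-rotation k w i)) ⟩
    ∑[ i ∈ allFin n ] bit (lookup w (rotateVertex (toℕ k) i))
      ≡⟨ ∑-rotateVertex (toℕ k) (bit ∘ lookup w) ⟩
    ∑[ i ∈ allFin n ] bit (lookup w i)
      ≡⟨ sym (ones≡∑ w) ⟩
    ones w ∎

  zeros-rotation : ∀ k w → zeros ((k , false) ▷ w) ≡ zeros w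
  zeros-rotation k w = begin
    zeros ((k , false) ▷ w)
      ≡⟨ zeros≡∑ ((k , false) ▷ w) ⟩
    ∑[ i ∈ allFin n ] bit (not (lookup ((k , false) ▷ w) i))
      ≡⟨ ∑-cong (allFin n) (λ i → cong (bit ∘ not) (lookup-rotation k w i)) ⟩
    ∑[ i ∈ allFin n ] bit (not (lookup w (rotateVertex (toℕ k) i)))
      ≡⟨ ∑-rotateVertex (toℕ k) (bit ∘ not ∘ lookup w) ⟩
    ∑[ i ∈ allFin n ] bit (not (lookup w i))
      ≡⟨ sym (zeros≡∑ w) ⟩
    zeros w ∎

  ones-reflection : ∀ k w → ones ((k , true) ▷ w) ≡ zeros w
  ones-reflection k w = begin
    ones ((k , true) ▷ w)
      ≡⟨ ones≡∑ ((k , true) ▷ w) ⟩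
    ∑[ i ∈ allFin n ] bit (lookup ((k , true) ▷ w) i)
      ≡⟨ ∑-cong (allFin n) (λ i → cong bit (lookup-reflection k w i)) ⟩
    ∑[ i ∈ allFin n ] bit (not (lookup w (reflectVertex (toℕ k) i)))
      ≡⟨ ∑-reflectVertex (toℕ k) (bit ∘ not ∘ lookup w) ⟩
    ∑[ i ∈ allFin n ] bit (not (lookup w i))
      ≡⟨ sym (zeros≡∑ w) ⟩
    zeros w ∎

  zeros-reflection : ∀ k w → zeros ((k , true) ▷ w) ≡ ones w
  zeros-reflection k w = begin
    zeros ((k , true) ▷ w)
      ≡⟨ zeros≡∑ ((k , true) ▷ w) ⟩
    ∑[ i ∈ allFin n ] bit (not (lookup ((k , true) ▷ w) i))
      ≡⟨ ∑-cong (allFin n) (λ i → cong (bit ∘ not) (lookup-reflection k w i)) ⟩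
    ∑[ i ∈ allFin n ] bit (not (not (lookup w (reflectVertex (toℕ k) i))))
      ≡⟨ ∑-cong (allFin n) (λ i → cong bit (Boolₚ.not-involutive _)) ⟩
    ∑[ i ∈ allFin n ] bit (lookup w (reflectVertex (toℕ k) i))
      ≡⟨ ∑-reflectVertex (toℕ k) (bit ∘ lookup w) ⟩
    ∑[ i ∈ allFin n ] bit (lookup w i)
      ≡⟨ sym (ones≡∑ w) ⟩
    ones w ∎

  cycleIndex-invariant : ∀ g w → cycleIndex (lookup (g ▷ w)) ≡ cycleIndex (lookup w)
  cycleIndex-invariant (k , false) w = cong₂ _⊔_ (ones-rotation k w) (zeros-rotation k w)
  cycleIndex-invariant (k , true)  w = trans (cong₂ _⊔_ (ones-reflection k w) (zeros-reflection k w)) (⊔-comm (zeros w) (ones w))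

  Periodic : ℕ → Word → Set
  Periodic d w = ∀ j → at w (j + d) ≡ at w j

  periodic-multiple : ∀ d w → Periodic d w → ∀ j c → at w (j + c * d) ≡ at w j
  periodic-multiple d w period j zero    = cong (at w) (+-identityʳ j)
  periodic-multiple d w period j (suc c) = begin
    at w (j + (d + c * d))   ≡⟨ cong (at w) (+-CS.x∙yz≈xz∙y j d (c * d)) ⟩
    at w (j + c * d + d)     ≡⟨ period (j + c * d) ⟩
    at w (j + c * d)         ≡⟨ periodic-multiple d w period j c ⟩
    at w j                   ∎

  n-periodic : ∀ w → Periodic n w
  n-periodic w j = at-cong w (+n≈ j)

  rotation-fixed⇔periodic : ∀ k w → (k , false) ▷ w ≡ w ⇔ Periodic (toℕ k) w
  rotation-fixed⇔periodic k w = mk⇔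
    (λ fixed j → trans (sym (at-▷ k false w j)) (cong (λ v → at v j) fixed))
    (λ period → word-ext λ j → trans (at-▷ k false w j) (period j))

  gcd-periodic : ∀ (k : Fin n) w → Periodic (toℕ k) w → Periodic (gcd (toℕ k) n) w
  gcd-periodic k w period j with Bézout.identity (gcd-GCD (toℕ k) n)
  ... | Bézout.+- x y g+yn≡xk = begin
    at w (j + g)              ≡⟨ sym (periodic-multiple n w (n-periodic w) (j + g) y) ⟩
    at w (j + g + y * n)      ≡⟨ cong (at w) (trans (+-assoc j g (y * n)) (cong (j +_) g+yn≡xk)) ⟩
    at w (j + x * toℕ k)      ≡⟨ periodic-multiple (toℕ k) w period j x ⟩
    at w j                    ∎
    where
    g : ℕ
    g = gcd (toℕ k) n
  ... | Bézout.-+ x y g+xk≡yn = begin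
    at w (j + g)              ≡⟨ sym (periodic-multiple (toℕ k) w period (j + g) x) ⟩
    at w (j + g + x * toℕ k)  ≡⟨ cong (at w) (trans (+-assoc j g (x * toℕ k)) (cong (j +_) g+xk≡yn)) ⟩
    at w (j + y * n)          ≡⟨ periodic-multiple n w (n-periodic w) j y ⟩
    at w j                    ∎
    where
    g : ℕ
    g = gcd (toℕ k) n

  rotation-fixed⇔gcd-periodic : ∀ k w → (k , false) ▷ w ≡ w ⇔ Periodic (gcdWith k) w
  rotation-fixed⇔gcd-periodic k w = mk⇔
    (gcd-periodic k w ∘ Equivalence.to (rotation-fixed⇔periodic k w))
    (λ period → Equivalence.from (rotation-fixed⇔periodic k w) (divisor-period period (gcd[m,n]∣m (toℕ k) n)))
    where
    divisor-period : ∀ {d e} → Periodic d w → d ∣ e → Periodic e w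
    divisor-period {d} period (divides c refl) j = periodic-multiple d w period j c

  module Repetition (d : ℕ) .{{_ : NonZero d}} (d∣n : d ∣ n) where
    private
      module Short = DihedralAction d

    repeat : Vec Bool d → Word
    repeat u = cyclic (Short.at u)

    at-repeat : ∀ u j → at (repeat u) j ≡ Short.at u j
    at-repeat u j = trans (at-cyclic (Short.at u) j) (Short.at-cong u (m∣n⇒o%n%m≡o%m d n j d∣n))

    repeat-periodic : ∀ u → Periodic d (repeat u)
    repeat-periodic u j = trans (at-repeat u (j + d)) (trans (Short.at-cong u (Short.+n≈ j)) (sym (at-repeat u j)))

    restrict : Word → Vec Bool d
    restrict w = Short.cyclic (at w)

    restrict-repeat : ∀ u → restrict (repeat u) ≡ u
    restrict-repeat u = Short.word-ext λ i → begin
      Short.at (restrict (repeat u)) i ≡⟨ Short.at-cyclic (at (repeat u)) i ⟩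
      at (repeat u) (i % d)            ≡⟨ at-repeat u (i % d) ⟩
      Short.at u (i % d)               ≡⟨ Short.at-cong u (Short.%-≈ i) ⟩
      Short.at u i                     ∎

    repeat-restrict : ∀ w → Periodic d w → repeat (restrict w) ≡ w
    repeat-restrict w period = word-ext λ j → begin
      at (repeat (restrict w)) j  ≡⟨ at-repeat (restrict w) j ⟩
      Short.at (restrict w) j     ≡⟨ Short.at-cyclic (at w) j ⟩
      at w (j % d)                ≡⟨ sym (periodic-multiple d w period (j % d) (j / d)) ⟩
      at w (j % d + j / d * d)    ≡⟨ cong (at w) (sym (m≡m%n+[m/n]*n j d)) ⟩
      at w j                      ∎

    repeat-injective : Injective _≡_ _≡_ repeat
    repeat-injective = retraction⇒injective restrict restrict-repeat

    ones-repeat : ∀ u → ones (repeat u) ≡ (n / d) * ones u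
    ones-repeat u = begin
      ones (repeat u)
        ≡⟨ ones≡∑< (repeat u) ⟩
      ∑[ i < n ] bit (at (repeat u) i)
        ≡⟨ ∑-cong (upTo n) (λ i → cong bit (trans (at-repeat u i) (sym (Short.at-cong u (Short.%-≈ i))))) ⟩
      ∑[ i < n ] bit (Short.at u (i % d))
        ≡⟨ cong (λ m → ∑[ i < m ] bit (Short.at u (i % d))) (sym (m/n*n≡m d∣n)) ⟩
      ∑[ i < n / d * d ] bit (Short.at u (i % d))
        ≡⟨ ∑<-periodic (n / d) d (bit ∘ Short.at u) ⟩
      n / d * ∑[ i < d ] bit (Short.at u i)
        ≡⟨ cong (n / d *_) (sym (Short-ones≡∑< u)) ⟩
      n / d * ones u ∎
      where
      Short-ones≡∑< : ∀ u → ones u ≡ ∑[ i < d ] bit (Short.at u i)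
      Short-ones≡∑< u = begin
        ones u                                   ≡⟨ countTrue≡∑ d (lookup u) ⟩
        ∑[ i ∈ allFin d ] bit (lookup u i)        ≡⟨ ∑-cong (allFin d) (λ i → cong bit (Short.lookup≡at u i)) ⟩
        ∑[ i ∈ allFin d ] bit (Short.at u (toℕ i)) ≡⟨ sym (∑<≡∑allFin d _) ⟩
        ∑[ i < d ] bit (Short.at u i)            ∎

  rotationFixedCount : Fin n → ℕ → ℕ
  rotationFixedCount k q = ∑[ w ∈ words n ] (δℕ (ones w) q * δW ((k , false) ▷ w) w)

  -- The value at period 0 is junk: it is only used at gcdWith k, which is never 0.
  periodicCount : ℕ → ℕ → ℕ
  periodicCount zero          q = 0
  periodicCount d@(suc _)     q = ∑[ u ∈ words d ] δℕ (n / d * ones u) q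

  periodicCount-nonZero : ∀ d .{{_ : NonZero d}} q → periodicCount d q ≡ ∑[ u ∈ words d ] δℕ (n / d * ones u) q
  periodicCount-nonZero (suc _) q = refl

  rotationFixedCount≡periodicCount : ∀ k q → rotationFixedCount k q ≡ periodicCount (gcdWith k) q
  rotationFixedCount≡periodicCount k q = sym (begin
    periodicCount g q                              ≡⟨ periodicCount-nonZero g q ⟩
    ∑[ u ∈ words g ] δℕ (n / g * ones u) q         ≡⟨ ∑-cong (words g) repeated ⟩
    ∑[ u ∈ words g ] counted (repeat u)            ≡⟨ ∑-reindex _≟W_ _≟V_ (words-enumerates n) (words-enumerates g)
                                                        repeat repeat-injective counted support ⟩
    rotationFixedCount k q                         ∎)
    where
    g = gcdWith k
    instance
      g-nonZero : NonZero g
      g-nonZero = gcdWith-nonZero k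
    open Repetition g (gcd[m,n]∣n (toℕ k) n)
    counted : Word → ℕ
    counted w = δℕ (ones w) q * δW ((k , false) ▷ w) w
    repeated : ∀ u → δℕ (n / g * ones u) q ≡ counted (repeat u)
    repeated u = begin
      δℕ (n / g * ones u) q
        ≡⟨ cong (λ m → δℕ m q) (sym (ones-repeat u)) ⟩
      δℕ (ones (repeat u)) q
        ≡⟨ sym (*-identityʳ _) ⟩
      δℕ (ones (repeat u)) q * 1
        ≡⟨ cong (δℕ (ones (repeat u)) q *_) (sym (Kronecker.δ-refl _≟W_ (repeat u))) ⟩
      δℕ (ones (repeat u)) q * δW (repeat u) (repeat u)
        ≡⟨ cong (λ v → δℕ (ones (repeat u)) q * δW v (repeat u)) (sym fixed) ⟩
      counted (repeat u) ∎
      where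
      fixed : (k , false) ▷ repeat u ≡ repeat u
      fixed = Equivalence.from (rotation-fixed⇔gcd-periodic k (repeat u)) (repeat-periodic u)
    support : ∀ w → 0 < counted w → ∃ λ u → repeat u ≡ w
    support w 0<counted with (k , false) ▷ w ≟W w
    ... | yes fixed = restrict w , repeat-restrict w (Equivalence.to (rotation-fixed⇔gcd-periodic k w) fixed)
    ... | no _      = contradiction (subst (0 <_) (*-zeroʳ (δℕ (ones w) q)) 0<counted) λ ()

  rotationFixedTotal : ℕ → ℕ
  rotationFixedTotal q = ∑[ k ∈ allFin n ] rotationFixedCount k q

  private
    period≡ : ∀ {i q} → suc i ∣ n → periodicCount (n / suc i) q ≡ ∑[ u ∈ words (n / suc i) ] δℕ (suc i * ones u) q
    period≡ {i} {q} i+1∣n = trans (periodicCount-nonZero (n / suc i) {{quotient-nonZero n (suc i) i+1∣n}} q)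
      (cong (λ m → ∑[ u ∈ words (n / suc i) ] δℕ (m * ones u) q)
            (n/[n/d]≡d n (suc i) {{_}} {{quotient-nonZero n (suc i) i+1∣n}} i+1∣n))

    classTerm : ∀ q i → classSize (suc i) * periodicCount (n / suc i) q ≡ indicator (suc i ∣? gcd n q) * term n q i
    classTerm q i with suc i ∣? n | suc i ∣? q
    ... | no i+1∤n | _ = begin
      classSize (suc i) * periodicCount (n / suc i) q
        ≡⟨ cong (_* periodicCount (n / suc i) q) (classSize-∤ (suc i) i+1∤n) ⟩
      0
        ≡⟨ cong (_* term n q i) (sym (indicator-no (suc i ∣? gcd n q) (i+1∤n ∘ (flip ∣-trans (gcd[m,n]∣m n q))))) ⟩
      indicator (suc i ∣? gcd n q) * term n q i ∎
    ... | yes i+1∣n | no i+1∤q = begin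
      classSize (suc i) * periodicCount (n / suc i) q
        ≡⟨ cong (classSize (suc i) *_) (trans (period≡ i+1∣n) (∑-words-δ-scaled-∤ (n / suc i) (suc i) q i+1∤q)) ⟩
      classSize (suc i) * 0
        ≡⟨ *-zeroʳ (classSize (suc i)) ⟩
      0
        ≡⟨ cong (_* term n q i) (sym (indicator-no (suc i ∣? gcd n q) (i+1∤q ∘ (flip ∣-trans (gcd[m,n]∣n n q))))) ⟩
      indicator (suc i ∣? gcd n q) * term n q i ∎
    ... | yes i+1∣n | yes i+1∣q = begin
      classSize (suc i) * periodicCount (n / suc i) q
        ≡⟨ cong₂ _*_ (classSize-∣ (suc i) i+1∣n)
                     (trans (period≡ i+1∣n) (∑-words-δ-scaled (n / suc i) (suc i) q i+1∣q)) ⟩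
      term n q i
        ≡⟨ sym (*-identityˡ _) ⟩
      1 * term n q i
        ≡⟨ cong (_* term n q i) (sym (indicator-yes (suc i ∣? gcd n q) (gcd-greatest i+1∣n i+1∣q))) ⟩
      indicator (suc i ∣? gcd n q) * term n q i ∎

  rotationFixedTotal≡divisorSum : ∀ q → rotationFixedTotal q ≡ divisorSum (gcd n q) (term n q)
  rotationFixedTotal≡divisorSum q = begin
    rotationFixedTotal q
      ≡⟨ ∑-cong (allFin n) (λ k → rotationFixedCount≡periodicCount k q) ⟩
    ∑[ k ∈ allFin n ] periodicCount (gcdWith k) q
      ≡⟨ ∑-gcdWith (λ d → periodicCount d q) ⟩
    ∑[ i < n ] (classSize (suc i) * periodicCount (n / suc i) q)
      ≡⟨ ∑-cong (upTo n) (classTerm q) ⟩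
    ∑[ i < n ] divisorTerm i
      ≡⟨ cong (λ m → ∑< m divisorTerm) (sym (m+[n∸m]≡n g≤n)) ⟩
    ∑< (g + (n ∸ g)) divisorTerm
      ≡⟨ ∑<-+ g (n ∸ g) divisorTerm ⟩
    ∑< g divisorTerm + ∑[ i < n ∸ g ] divisorTerm (g + i)
      ≡⟨ cong (∑< g divisorTerm +_) (trans (∑-cong (upTo (n ∸ g)) beyond) (∑-zero (upTo (n ∸ g)))) ⟩
    ∑< g divisorTerm + 0
      ≡⟨ +-identityʳ _ ⟩
    ∑< g divisorTerm
      ≡⟨ sym (∑-filter (λ k → suc k ∣? g) (upTo g) (term n q)) ⟩
    ∑ (filter (λ k → suc k ∣? g) (upTo g)) (term n q)
      ≡⟨ ∑≡sum∘map (filter (λ k → suc k ∣? g) (upTo g)) (term n q) ⟩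
    divisorSum g (term n q) ∎
    where
    g = gcd n q
    divisorTerm : ℕ → ℕ
    divisorTerm i = indicator (suc i ∣? g) * term n q i
    g≤n : g ≤ n
    g≤n = ∣⇒≤ (gcd[m,n]∣m n q)
    beyond : ∀ i → divisorTerm (g + i) ≡ 0
    beyond i = cong (_* term n q (g + i)) (indicator-no (suc (g + i) ∣? g) λ g+i+1∣g →
      <⇒≱ (s≤s (m≤m+n g i)) (∣⇒≤ {{≢-nonZero (gcd[m,n]≢0 n q (inj₁ (≢-nonZero⁻¹ n)))}} g+i+1∣g))

  complement : Word → Word
  complement = Vec.map not

  at-complement : ∀ w j → at (complement w) j ≡ not (at w j)
  at-complement w j = Vecₚ.lookup-map (toFin j) not w

  complement-involutive : ∀ w → complement (complement w) ≡ w
  complement-involutive w = word-ext λ j →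
    trans (at-complement (complement w) j) (trans (cong not (at-complement w j)) (Boolₚ.not-involutive _))

  rotation-complement : ∀ k w → (k , false) ▷ complement w ≡ complement ((k , false) ▷ w)
  rotation-complement k w = word-ext λ j → begin
    at ((k , false) ▷ complement w) j       ≡⟨ at-▷ k false (complement w) j ⟩
    at (complement w) (j + toℕ k)           ≡⟨ at-complement w _ ⟩
    not (at w (j + toℕ k))                  ≡⟨ cong not (sym (at-▷ k false w j)) ⟩
    not (at ((k , false) ▷ w) j)            ≡⟨ sym (at-complement ((k , false) ▷ w) j) ⟩
    at (complement ((k , false) ▷ w)) j     ∎

  ones-complement : ∀ w → ones (complement w) ≡ n ∸ ones w
  ones-complement w = begin
    ones (complement w)
      ≡⟨ ones≡∑ (complement w) ⟩
    ∑[ i ∈ allFin n ] bit (lookup (complement w) i)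
      ≡⟨ ∑-cong (allFin n) (λ i → cong bit (Vecₚ.lookup-map i not w)) ⟩
    ∑[ i ∈ allFin n ] bit (not (lookup w i))
      ≡⟨ sym (zeros≡∑ w) ⟩
    zeros w
      ≡⟨ zeros≡n∸ones w ⟩
    n ∸ ones w ∎

  rotationFixedCount-complement : ∀ k p → p ≤ n → rotationFixedCount k (n ∸ p) ≡ rotationFixedCount k p
  rotationFixedCount-complement k p p≤n = begin
    rotationFixedCount k (n ∸ p)
      ≡⟨ sym (∑-permute _≟W_ (words-enumerates n) complement complement complement-involutive complement-involutive _) ⟩
    ∑[ w ∈ words n ] (δℕ (ones (complement w)) (n ∸ p) * δW ((k , false) ▷ complement w) (complement w))
      ≡⟨ ∑-cong (words n) complemented ⟩
    rotationFixedCount k p ∎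
    where
    complemented : ∀ w → δℕ (ones (complement w)) (n ∸ p) * δW ((k , false) ▷ complement w) (complement w)
                       ≡ δℕ (ones w) p * δW ((k , false) ▷ w) w
    complemented w = cong₂ _*_
      (trans (cong (λ m → δℕ m (n ∸ p)) (ones-complement w)) (δ-injective-∸ (ones≤n w) p≤n))
      (trans (cong (λ v → δW v (complement w)) (rotation-complement k w))
             (δ-injective _≟W_ _≟W_ complement (retraction⇒injective complement complement-involutive) ((k , false) ▷ w) w))
      where
      δ-injective-∸ : ∀ {a b} → a ≤ n → b ≤ n → δℕ (n ∸ a) (n ∸ b) ≡ δℕ a b
      δ-injective-∸ {a} {b} a≤n b≤n with a ≟ b
      ... | yes refl = trans (δℕ-refl (n ∸ a)) (sym (δℕ-refl a))
      ... | no a≢b   = trans (δℕ-≢ (a≢b ∘ ∸-cancelˡ-≡ a≤n b≤n)) (sym (δℕ-≢ a≢b))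

  rotationFixedTotal-complement : ∀ p → p ≤ n → rotationFixedTotal (n ∸ p) ≡ rotationFixedTotal p
  rotationFixedTotal-complement p p≤n = ∑-cong (allFin n) (λ k → rotationFixedCount-complement k p p≤n)

  reflectionFixedCount : ℕ → ℕ
  reflectionFixedCount m = ∑[ w ∈ words n ] δW ((toFin m , true) ▷ w) w

  reflectionFixedCount-+2 : ∀ m → reflectionFixedCount (2 + m) ≡ reflectionFixedCount m
  reflectionFixedCount-+2 m = begin
    reflectionFixedCount (2 + m)
      ≡⟨ sym (∑-permute _≟W_ (words-enumerates n) (r ⁻¹ ▷_) (r ▷_) (⁻¹-▷ r) (▷-⁻¹ r) _) ⟩
    ∑[ w ∈ words n ] δW (ρ ▷ r ⁻¹ ▷ w) (r ⁻¹ ▷ w)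
      ≡⟨ ∑-cong (words n) conjugated ⟩
    reflectionFixedCount m ∎
    where
    r = rotationBy1
    ρ = toFin (2 + m) , true
    conjugated : ∀ w → δW (ρ ▷ r ⁻¹ ▷ w) (r ⁻¹ ▷ w) ≡ δW ((toFin m , true) ▷ w) w
    conjugated w = begin
      δW (ρ ▷ r ⁻¹ ▷ w) (r ⁻¹ ▷ w)
        ≡⟨ sym (δ-injective _≟W_ _≟W_ (r ▷_) (retraction⇒injective (r ⁻¹ ▷_) (⁻¹-▷ r))
                 (ρ ▷ r ⁻¹ ▷ w) (r ⁻¹ ▷ w)) ⟩
      δW (r ▷ ρ ▷ r ⁻¹ ▷ w) (r ▷ r ⁻¹ ▷ w)
        ≡⟨ cong₂ δW (trans (cong (r ▷_) (·-▷ ρ (r ⁻¹) w)) (·-▷ r (ρ · (r ⁻¹)) w)) (▷-⁻¹ r w) ⟩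
      δW ((r · (ρ · (r ⁻¹))) ▷ w) w
        ≡⟨ cong (λ g → δW (g ▷ w) w) (reflection-conjugate m) ⟩
      δW ((toFin m , true) ▷ w) w ∎

  reflectionFixedCount-even : ∀ t → reflectionFixedCount (t + t) ≡ 0
  -- Edge 0 is mapped to itself with its direction reversed.
  reflectionFixedCount-even zero    = trans (∑-cong (words n) not-fixed) (∑-zero (words n))
    where
    not-fixed : ∀ w → δW ((toFin 0 , true) ▷ w) w ≡ 0
    not-fixed w = Kronecker.δ-≢ _≟W_ {(toFin 0 , true) ▷ w} {w} λ fixed → Boolₚ.not-¬ refl (begin
      at w 0
        ≡⟨ cong (λ v → at v 0) (sym fixed) ⟩
      at ((toFin 0 , true) ▷ w) 0
        ≡⟨ at-▷ (toFin 0) true w 0 ⟩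
      not (at w (toℕ (toFin 0) + neg 0))
        ≡⟨ cong not (at-cong w (≈-trans (+-congʳ (neg 0) (toℕ-toFin-≈ 0)) (+-inverseʳ 0))) ⟩
      not (at w 0) ∎)
  reflectionFixedCount-even (suc t) = begin
    reflectionFixedCount (suc t + suc t)   ≡⟨ cong (λ m → reflectionFixedCount (suc m)) (+-suc t t) ⟩
    reflectionFixedCount (2 + (t + t))     ≡⟨ reflectionFixedCount-+2 (t + t) ⟩
    reflectionFixedCount (t + t)           ≡⟨ reflectionFixedCount-even t ⟩
    0                                      ∎

  reflectionFixedCount-odd : ∀ t → reflectionFixedCount (t + t + 1) ≡ reflectionFixedCount 1
  reflectionFixedCount-odd zero    = refl
  reflectionFixedCount-odd (suc t) = begin
    reflectionFixedCount (suc t + suc t + 1) ≡⟨ cong (λ m → reflectionFixedCount (suc m + 1)) (+-suc t t) ⟩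
    reflectionFixedCount (2 + (t + t + 1))   ≡⟨ reflectionFixedCount-+2 (t + t + 1) ⟩
    reflectionFixedCount (t + t + 1)         ≡⟨ reflectionFixedCount-odd t ⟩
    reflectionFixedCount 1                   ∎

  -- For n = h + h the reflection j ↦ n − 1 − j pairs each position j < h with one ≥ h, so its fixed
  -- words are determined by their first halves.
  module Mirror (h : ℕ) (n≡h+h : n ≡ h + h) where

    private
      readHalf′ : Vec Bool h → (i : ℕ) → Dec (i < h) → Bool
      readHalf′ u i (yes i<h) = lookup u (fromℕ< i<h)
      readHalf′ u i (no _)    = false

      mirrored′ : Vec Bool h → (j : ℕ) → Dec (j < h) → Bool
      mirrored′ u j (yes _) = readHalf′ u j (j <? h)
      mirrored′ u j (no _)  = not (readHalf′ u (n ∸ suc j) (n ∸ suc j <? h))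

    readHalf : Vec Bool h → ℕ → Bool
    readHalf u i = readHalf′ u i (i <? h)

    readHalf-< : ∀ u {i} (i<h : i < h) → readHalf u i ≡ lookup u (fromℕ< i<h)
    readHalf-< u {i} i<h = by-cases (i <? h)
      where
      by-cases : (d : Dec (i < h)) → readHalf′ u i d ≡ lookup u (fromℕ< i<h)
      by-cases (yes i<h′) = cong (lookup u) (Finₚ.fromℕ<-cong i i refl i<h′ i<h)
      by-cases (no i≮h)   = contradiction i<h i≮h

    mirrored : Vec Bool h → ℕ → Bool
    mirrored u j = mirrored′ u j (j <? h)

    mirrored-< : ∀ u {j} → j < h → mirrored u j ≡ readHalf u j
    mirrored-< u {j} j<h = by-cases (j <? h)
      where
      by-cases : (d : Dec (j < h)) → mirrored′ u j d ≡ readHalf u j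
      by-cases (yes _)  = refl
      by-cases (no j≮h) = contradiction j<h j≮h

    mirrored-≮ : ∀ u {j} → ¬ j < h → mirrored u j ≡ not (readHalf u (n ∸ suc j))
    mirrored-≮ u {j} j≮h = by-cases (j <? h)
      where
      by-cases : (d : Dec (j < h)) → mirrored′ u j d ≡ not (readHalf u (n ∸ suc j))
      by-cases (yes j<h) = contradiction j<h j≮h
      by-cases (no _)    = refl

    private
      n∸suc[n∸suc[j]]≡j : ∀ {j} → j < n → n ∸ suc (n ∸ suc j) ≡ j
      n∸suc[n∸suc[j]]≡j {j} j<n = begin
        n ∸ suc (n ∸ suc j)    ≡⟨ cong (n ∸_) (+-comm 1 (n ∸ suc j)) ⟩
        n ∸ (n ∸ suc j + 1)    ≡⟨ sym (∸-+-assoc n (n ∸ suc j) 1) ⟩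
        n ∸ (n ∸ suc j) ∸ 1    ≡⟨ cong (_∸ 1) (m∸[m∸n]≡n j<n) ⟩
        j                      ∎

      h≤n∸suc[j] : ∀ {j} → j < h → h ≤ n ∸ suc j
      h≤n∸suc[j] {j} j<h = subst (h ≤_) (cong (_∸ suc j) (sym n≡h+h))
        (subst (_≤ (h + h) ∸ suc j) (m+n∸n≡m h h) (∸-monoʳ-≤ (h + h) j<h))

      n∸suc[j]<h : ∀ {j} → ¬ j < h → j < n → n ∸ suc j < h
      n∸suc[j]<h {j} j≮h j<n =
        +-cancelʳ-≤ j (suc (n ∸ suc j)) h (≤-trans (≤-reflexive sum≡h+h) (+-monoʳ-≤ h (≮⇒≥ j≮h)))
        where
        sum≡h+h : suc (n ∸ suc j) + j ≡ h + h
        sum≡h+h = trans (sym (+-suc (n ∸ suc j) j)) (trans (m∸n+n≡m j<n) n≡h+h)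

    mirrored-antisymmetric : ∀ u {j} → j < n → mirrored u j ≡ not (mirrored u (n ∸ suc j))
    mirrored-antisymmetric u {j} j<n = by-cases (j <? h)
      where
      by-cases : Dec (j < h) → mirrored u j ≡ not (mirrored u (n ∸ suc j))
      by-cases (yes j<h) = trans (mirrored-< u j<h) (sym (begin
        not (mirrored u (n ∸ suc j))                 ≡⟨ cong not (mirrored-≮ u (λ lt → <⇒≱ lt (h≤n∸suc[j] j<h))) ⟩
        not (not (readHalf u (n ∸ suc (n ∸ suc j)))) ≡⟨ Boolₚ.not-involutive _ ⟩
        readHalf u (n ∸ suc (n ∸ suc j))             ≡⟨ cong (readHalf u) (n∸suc[n∸suc[j]]≡j j<n) ⟩
        readHalf u j                                 ∎))
      by-cases (no j≮h) = trans (mirrored-≮ u j≮h) (cong not (sym (mirrored-< u (n∸suc[j]<h j≮h j<n))))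

    mirror : Vec Bool h → Word
    mirror u = cyclic (mirrored u)

    lastReflection : Dihedral
    lastReflection = toFin (n ∸ 1) , true

    private
      h≤n : h ≤ n
      h≤n = subst (h ≤_) (sym n≡h+h) (m≤m+n h h)

      n∸suc[j]<n : ∀ j → n ∸ suc j < n
      n∸suc[j]<n j = ≤-<-trans (∸-monoʳ-≤ n (s≤s (z≤n {j}))) (∸-monoʳ-< (s≤s z≤n) (>-nonZero⁻¹ n))

      reversed-index : ∀ j → j < n → toℕ (toFin (n ∸ 1)) + neg j ≈ n ∸ suc j
      reversed-index j j<n = +-cancelʳ (suc j) (begin
        (toℕ (toFin (n ∸ 1)) + neg j + suc j) % n ≡⟨ +-congʳ (suc j) (+-congʳ (neg j) (toℕ-toFin-≈ (n ∸ 1))) ⟩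
        (n ∸ 1 + neg j + suc j) % n               ≡⟨ ≡⇒≈ (+-suc (n ∸ 1 + neg j) j) ⟩
        suc (n ∸ 1 + neg j + j) % n               ≡⟨ +-congˡ 1 (m+neg[n]+n≈m (n ∸ 1) j) ⟩
        suc (n ∸ 1) % n                           ≡⟨ cong (_% n) (suc-pred n) ⟩
        n % n                                     ≡⟨ cong (_% n) (sym (m∸n+n≡m j<n)) ⟩
        (n ∸ suc j + suc j) % n                   ∎)

    at-lastReflection : ∀ w j → at (lastReflection ▷ w) j ≡ not (at w (n ∸ suc (j % n)))
    at-lastReflection w j = trans (at-▷ (toFin (n ∸ 1)) true w j) (cong not (at-cong w (begin
      (toℕ (toFin (n ∸ 1)) + neg j) % n       ≡⟨ +-congˡ _ (neg-cong (≈-sym (%-≈ j))) ⟩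
      (toℕ (toFin (n ∸ 1)) + neg (j % n)) % n ≡⟨ reversed-index (j % n) (m%n<n j n) ⟩
      (n ∸ suc (j % n)) % n                   ∎)))

    mirror-fixed : ∀ u → lastReflection ▷ mirror u ≡ mirror u
    mirror-fixed u = word-ext λ j → begin
      at (lastReflection ▷ mirror u) j
        ≡⟨ at-lastReflection (mirror u) j ⟩
      not (at (mirror u) (n ∸ suc (j % n)))
        ≡⟨ cong not (trans (at-cyclic (mirrored u) _) (cong (mirrored u) (<⇒%-≡ (n∸suc[j]<n (j % n))))) ⟩
      not (mirrored u (n ∸ suc (j % n)))
        ≡⟨ sym (mirrored-antisymmetric u (m%n<n j n)) ⟩
      mirrored u (j % n)
        ≡⟨ sym (at-cyclic (mirrored u) j) ⟩
      at (mirror u) j ∎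

    firstHalf : Word → Vec Bool h
    firstHalf w = Vec.tabulate (at w ∘ toℕ)

    readHalf-firstHalf : ∀ w {i} → i < h → readHalf (firstHalf w) i ≡ at w i
    readHalf-firstHalf w {i} i<h = begin
      readHalf (firstHalf w) i                 ≡⟨ readHalf-< (firstHalf w) i<h ⟩
      lookup (firstHalf w) (fromℕ< i<h)        ≡⟨ Vecₚ.lookup∘tabulate _ (fromℕ< i<h) ⟩
      at w (toℕ (fromℕ< i<h))                  ≡⟨ cong (at w) (Finₚ.toℕ-fromℕ< i<h) ⟩
      at w i                                   ∎

    firstHalf-mirror : ∀ u → firstHalf (mirror u) ≡ u
    firstHalf-mirror u = trans (Vecₚ.tabulate-cong first) (Vecₚ.tabulate∘lookup u)
      where
      first : ∀ i → at (mirror u) (toℕ i) ≡ lookup u i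
      first i = begin
        at (mirror u) (toℕ i)                 ≡⟨ at-cyclic (mirrored u) (toℕ i) ⟩
        mirrored u (toℕ i % n)                ≡⟨ cong (mirrored u) (<⇒%-≡ (≤-trans (Finₚ.toℕ<n i) h≤n)) ⟩
        mirrored u (toℕ i)                    ≡⟨ mirrored-< u (Finₚ.toℕ<n i) ⟩
        readHalf u (toℕ i)                    ≡⟨ readHalf-< u (Finₚ.toℕ<n i) ⟩
        lookup u (fromℕ< (Finₚ.toℕ<n i))      ≡⟨ cong (lookup u) (Finₚ.fromℕ<-toℕ i (Finₚ.toℕ<n i)) ⟩
        lookup u i                            ∎

    mirror-firstHalf : ∀ w → lastReflection ▷ w ≡ w → mirror (firstHalf w) ≡ w
    mirror-firstHalf w fixed = word-ext λ j → trans (at-cyclic (mirrored (firstHalf w)) j) (by-cases j (j % n <? h))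
      where
      by-cases : ∀ j → Dec (j % n < h) → mirrored (firstHalf w) (j % n) ≡ at w j
      by-cases j (yes j%n<h) = begin
        mirrored (firstHalf w) (j % n)   ≡⟨ mirrored-< (firstHalf w) j%n<h ⟩
        readHalf (firstHalf w) (j % n)   ≡⟨ readHalf-firstHalf w j%n<h ⟩
        at w (j % n)                     ≡⟨ at-cong w (%-≈ j) ⟩
        at w j                           ∎
      by-cases j (no j%n≮h) = begin
        mirrored (firstHalf w) (j % n)
          ≡⟨ mirrored-≮ (firstHalf w) j%n≮h ⟩
        not (readHalf (firstHalf w) (n ∸ suc (j % n)))
          ≡⟨ cong not (readHalf-firstHalf w (n∸suc[j]<h j%n≮h (m%n<n j n))) ⟩
        not (at w (n ∸ suc (j % n)))
          ≡⟨ sym (at-lastReflection w j) ⟩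
        at (lastReflection ▷ w) j
          ≡⟨ cong (λ v → at v j) fixed ⟩
        at w j ∎

    reflectionFixedCount-last : reflectionFixedCount (n ∸ 1) ≡ 2 ^ h
    reflectionFixedCount-last = begin
      reflectionFixedCount (n ∸ 1)             ≡⟨ sym (∑-reindex _≟W_ _≟V_ (words-enumerates n) (words-enumerates h)
                                                     mirror (retraction⇒injective firstHalf firstHalf-mirror) fixes support) ⟩
      ∑[ u ∈ words h ] fixes (mirror u)        ≡⟨ ∑-cong (words h) mirrors-fixed ⟩
      ∑[ u ∈ words h ] 1                       ≡⟨ trans (∑-const (words h) 1) (*-identityʳ _) ⟩
      length (words h)                         ≡⟨ length-vectors bools h ⟩
      2 ^ h                                    ∎
      where
      fixes : Word → ℕ
      fixes w = δW (lastReflection ▷ w) w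
      mirrors-fixed : ∀ u → fixes (mirror u) ≡ 1
      mirrors-fixed u = trans (cong (λ v → δW v (mirror u)) (mirror-fixed u)) (Kronecker.δ-refl _≟W_ (mirror u))
      support : ∀ w → 0 < fixes w → ∃ λ u → mirror u ≡ w
      support w 0<fixes = firstHalf w , mirror-firstHalf w (Kronecker.δ-positive _≟W_ 0<fixes)

  ∑-reflectionFixedCount : ∀ h → n ≡ h + h → ∑[ k ∈ allFin n ] reflectionFixedCount (toℕ k) ≡ h * 2 ^ h
  ∑-reflectionFixedCount zero      n≡0     = contradiction n≡0 (≢-nonZero⁻¹ n)
  ∑-reflectionFixedCount h@(suc t) n≡h+h = begin
    ∑[ k ∈ allFin n ] reflectionFixedCount (toℕ k)
      ≡⟨ sym (∑<≡∑allFin n reflectionFixedCount) ⟩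
    ∑< n reflectionFixedCount
      ≡⟨ cong (λ m → ∑< m reflectionFixedCount) n≡h+h ⟩
    ∑< (h + h) reflectionFixedCount
      ≡⟨ ∑<-period2 reflectionFixedCount reflectionFixedCount-+2 h ⟩
    h * (reflectionFixedCount 0 + reflectionFixedCount 1)
      ≡⟨ cong (λ r → h * (r + reflectionFixedCount 1)) (reflectionFixedCount-even 0) ⟩
    h * reflectionFixedCount 1
      ≡⟨ cong (h *_) (sym (reflectionFixedCount-odd t)) ⟩
    h * reflectionFixedCount (t + t + 1)
      ≡⟨ cong (λ m → h * reflectionFixedCount m) (sym n∸1≡t+t+1) ⟩
    h * reflectionFixedCount (n ∸ 1)
      ≡⟨ cong (h *_) (Mirror.reflectionFixedCount-last h n≡h+h) ⟩
    h * 2 ^ h ∎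
    where
    n∸1≡t+t+1 : n ∸ 1 ≡ t + t + 1
    n∸1≡t+t+1 = trans (cong (_∸ 1) n≡h+h) (trans (+-suc t t) (+-comm 1 (t + t)))

  fixedWithIndex : Dihedral → ℕ → ℕ
  fixedWithIndex g p = ∑[ w ∈ words n ] (δℕ (cycleIndex (lookup w)) p * δW (g ▷ w) w)

  cycleIndex≡ : ∀ w → cycleIndex (lookup w) ≡ ones w ⊔ (n ∸ ones w)
  cycleIndex≡ w = cong (ones w ⊔_) (zeros≡n∸ones w)

  reflection-fixed⇒balanced : ∀ k w → (k , true) ▷ w ≡ w → ones w ≡ n ∸ ones w
  reflection-fixed⇒balanced k w fixed = trans (cong ones (sym fixed)) (trans (ones-reflection k w) (zeros≡n∸ones w))

  reflection-fixed⇒cycleIndex≡ones : ∀ k w → (k , true) ▷ w ≡ w → cycleIndex (lookup w) ≡ ones w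
  reflection-fixed⇒cycleIndex≡ones k w fixed =
    trans (cycleIndex≡ w) (trans (cong (ones w ⊔_) (sym (reflection-fixed⇒balanced k w fixed))) (⊔-idem (ones w)))

  module _ {p : ℕ} (p≤n : p ≤ n) (n∸p≤p : n ∸ p ≤ p) where

    fixedWithIndex-rotation : p ≢ n ∸ p → ∀ k →
      fixedWithIndex (k , false) p ≡ rotationFixedCount k p + rotationFixedCount k (n ∸ p)
    fixedWithIndex-rotation p≢n∸p k = trans (∑-cong (words n) split) (∑-+ (words n) _ _)
      where
      split : ∀ w → δℕ (cycleIndex (lookup w)) p * δW ((k , false) ▷ w) w
                  ≡ δℕ (ones w) p * δW ((k , false) ▷ w) w + δℕ (ones w) (n ∸ p) * δW ((k , false) ▷ w) w
      split w = trans (cong (λ c → δℕ c p * δW ((k , false) ▷ w) w) (cycleIndex≡ w))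
        (trans (cong (_* δW ((k , false) ▷ w) w) (δ-max-complement p≤n n∸p≤p (ones≤n w) p≢n∸p))
               (*-distribʳ-+ (δW ((k , false) ▷ w) w) (δℕ (ones w) p) _))

    fixedWithIndex-rotation-half : p ≡ n ∸ p → ∀ k → fixedWithIndex (k , false) p ≡ rotationFixedCount k p
    fixedWithIndex-rotation-half p≡n∸p k = ∑-cong (words n) λ w →
      cong (_* δW ((k , false) ▷ w) w)
           (trans (cong (λ c → δℕ c p) (cycleIndex≡ w)) (δ-max-complement-half p≤n n∸p≤p (ones≤n w) p≡n∸p))

    fixedWithIndex-reflection : p ≢ n ∸ p → ∀ k → fixedWithIndex (k , true) p ≡ 0
    fixedWithIndex-reflection p≢n∸p k = trans (∑-cong (words n) vanishes) (∑-zero (words n))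
      where
      vanishes : ∀ w → δℕ (cycleIndex (lookup w)) p * δW ((k , true) ▷ w) w ≡ 0
      vanishes w with (k , true) ▷ w ≟W w
      ... | no _       = *-zeroʳ (δℕ (cycleIndex (lookup w)) p)
      ... | yes fixed  = cong (_* 1) (δℕ-≢ λ c≡p → p≢n∸p (begin
        p                 ≡⟨ sym c≡p ⟩
        cycleIndex (lookup w) ≡⟨ reflection-fixed⇒cycleIndex≡ones k w fixed ⟩
        ones w            ≡⟨ reflection-fixed⇒balanced k w fixed ⟩
        n ∸ ones w        ≡⟨ cong (n ∸_) (trans (sym (reflection-fixed⇒cycleIndex≡ones k w fixed)) c≡p) ⟩
        n ∸ p             ∎))

    fixedWithIndex-reflection-half : p ≡ n ∸ p → ∀ k → fixedWithIndex (k , true) p ≡ reflectionFixedCount (toℕ k)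
    fixedWithIndex-reflection-half p≡n∸p k = ∑-cong (words n) counted
      where
      balanced-unique : ∀ {x y} → x ≤ n → y ≤ n → x ≡ n ∸ x → y ≡ n ∸ y → x ≡ y
      balanced-unique {x} {y} x≤n y≤n x≡n∸x y≡n∸y = *-cancelˡ-≡ x y 2 (begin
        x + (x + 0) ≡⟨ cong (x +_) (+-identityʳ x) ⟩
        x + x       ≡⟨ cong (x +_) x≡n∸x ⟩
        x + (n ∸ x) ≡⟨ m+[n∸m]≡n x≤n ⟩
        n           ≡⟨ sym (m+[n∸m]≡n y≤n) ⟩
        y + (n ∸ y) ≡⟨ cong (y +_) (sym y≡n∸y) ⟩
        y + y       ≡⟨ cong (y +_) (sym (+-identityʳ y)) ⟩
        y + (y + 0) ∎)
      counted : ∀ w → δℕ (cycleIndex (lookup w)) p * δW ((k , true) ▷ w) w ≡ δW ((toFin (toℕ k) , true) ▷ w) w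
      counted w = trans (counted′ w) (cong (λ k′ → δW ((k′ , true) ▷ w) w) (sym (toFin-toℕ k)))
        where
        counted′ : ∀ w → δℕ (cycleIndex (lookup w)) p * δW ((k , true) ▷ w) w ≡ δW ((k , true) ▷ w) w
        counted′ w with (k , true) ▷ w ≟W w
        ... | no _      = *-zeroʳ (δℕ (cycleIndex (lookup w)) p)
        ... | yes fixed = cong (_* 1) (trans (cong (λ c → δℕ c p) c≡p) (δℕ-refl p))
          where
          c≡p : cycleIndex (lookup w) ≡ p
          c≡p = trans (reflection-fixed⇒cycleIndex≡ones k w fixed)
                      (balanced-unique (ones≤n w) p≤n (reflection-fixed⇒balanced k w fixed) p≡n∸p)

-- The number of isomorphism classes

module IsomorphismClasses (n : ℕ) .{{_ : NonZero n}} (3≤n : 3 ≤ n)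
  (p : ℕ) (p≤n : p ≤ n) (n∸p≤p : n ∸ p ≤ p) where

  open DihedralAction n
  open CycleIsomorphisms n 3≤n using (▷-Iso; Iso⇒∼)
  open Counting n

  _≟D_ : DecidableEquality Dihedral
  _≟D_ = Prodₚ.≡-dec Finₚ._≟_ Boolₚ._≟_

  dihedralGroup : List Dihedral
  dihedralGroup = cartesianProductWith _,_ (allFin n) bools

  dihedralGroup-enumerates : Kronecker.Enumerates _≟D_ dihedralGroup
  dihedralGroup-enumerates = cartesianProductWith-enumerates Finₚ._≟_ Boolₚ._≟_ _≟D_ _,_ Prodₚ.,-injective
    (λ (k , b) → k , b , refl) (allFin-enumerates n) bools-enumerates

  HasIndex : Word → Set
  HasIndex w = cycleIndex (lookup w) ≡ p

  open Burnside _≟W_ _≟D_ (words-enumerates n) dihedralGroup-enumerates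
    _·_ _⁻¹ ε _▷_ ·-▷ ε-▷ ⁻¹-▷ ·-⁻¹-cancel ·-⁻¹-cancel′
    {HasIndex} (λ w → cycleIndex (lookup w) ≟ p) (λ g {w} → trans (cycleIndex-invariant g w))
    using (_∼_; representatives; representatives-valid; representatives-cover; Representatives; fixedPointCount; burnside)
  open Representatives

  classCount : ℕ
  classCount = length representatives

  isoClassCount : IsoClassCount n p classCount
  isoClassCount = map lookup representatives , length-map lookup representatives ,
    Allₚ.map⁺ (all-P representatives-valid) ,
    AllPairsₚ.map⁺ (AllPairs.map (λ {r} {s} r≁s iso → r≁s (Iso⇒∼ r s iso)) (unrelated representatives-valid)) ,
    covered
    where
    covered : ∀ o → cycleIndex o ≡ p → Any (Iso o) (map lookup representatives)
    covered o o-index = Anyₚ.map⁺ (Any.map (λ {r} → iso {r}) (representatives-cover w w-index))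
      where
      w = Vec.tabulate o
      o≗w : ∀ i → o i ≡ lookup w i
      o≗w i = sym (Vecₚ.lookup∘tabulate o i)
      w-index : HasIndex w
      w-index = trans (sym (cong₂ _⊔_ (countTrue-cong o≗w) (countFalse-cong o≗w))) o-index
      iso : ∀ {r} → r ∼ w → Iso o (lookup r)
      iso {r} (g , g▷r≡w) =
        Iso-respects-≗ {o′ = lookup r} (λ i → trans (o≗w i) (cong (λ v → lookup v i) (sym g▷r≡w))) (▷-Iso g r)

  length-dihedralGroup : length dihedralGroup ≡ n * 2
  length-dihedralGroup =
    trans (length-cartesianProductWith _,_ (allFin n) bools) (cong (_* 2) (length-tabulate {n = n} id))

  fixedTotal : ℕ
  fixedTotal = ∑[ k ∈ allFin n ] (fixedWithIndex (k , true) p + fixedWithIndex (k , false) p)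

  burnside-count : classCount * (n * 2) ≡ fixedTotal
  burnside-count = begin
    classCount * (n * 2)
      ≡⟨ cong (classCount *_) (sym length-dihedralGroup) ⟩
    classCount * length dihedralGroup
      ≡⟨ burnside ⟩
    ∑ dihedralGroup fixedPointCount
      ≡⟨ ∑-cartesianProductWith _,_ (allFin n) bools fixedPointCount ⟩
    ∑[ k ∈ allFin n ] (fixedPointCount (k , true) + (fixedPointCount (k , false) + 0))
      ≡⟨ ∑-cong (allFin n) (λ k → cong (fixedPointCount (k , true) +_) (+-identityʳ _)) ⟩
    fixedTotal
      ∎

  count-unbalanced : 2 * p ≢ n → n * classCount ≡ divisorSum (gcd n p) (term n p)
  count-unbalanced 2p≢n =
    trans (*-cancelʳ-≡ (n * classCount) (rotationFixedTotal p) 2 doubled) (rotationFixedTotal≡divisorSum p)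
    where
    p≢n∸p : p ≢ n ∸ p
    p≢n∸p p≡n∸p = 2p≢n (trans (cong (p +_) (+-identityʳ p)) (trans (cong (p +_) p≡n∸p) (m+[n∸m]≡n p≤n)))
    doubled : n * classCount * 2 ≡ rotationFixedTotal p * 2
    doubled = begin
      n * classCount * 2
        ≡⟨ trans (cong (_* 2) (*-comm n classCount)) (*-assoc classCount n 2) ⟩
      classCount * (n * 2)
        ≡⟨ burnside-count ⟩
      fixedTotal
        ≡⟨ ∑-cong (allFin n) (λ k → cong₂ _+_ (fixedWithIndex-reflection p≤n n∸p≤p p≢n∸p k)
                                              (fixedWithIndex-rotation p≤n n∸p≤p p≢n∸p k)) ⟩
      ∑[ k ∈ allFin n ] (rotationFixedCount k p + rotationFixedCount k (n ∸ p))
        ≡⟨ ∑-+ (allFin n) _ _ ⟩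
      rotationFixedTotal p + rotationFixedTotal (n ∸ p)
        ≡⟨ cong (rotationFixedTotal p +_) (rotationFixedTotal-complement p p≤n) ⟩
      rotationFixedTotal p + rotationFixedTotal p
        ≡⟨ trans (cong (rotationFixedTotal p +_) (sym (+-identityʳ _))) (*-comm 2 (rotationFixedTotal p)) ⟩
      rotationFixedTotal p * 2
        ∎

  count-balanced : 2 * p ≡ n →
    2 * n * classCount ≡ divisorSum (gcd n (n / 2)) (term n (n / 2)) + 2 * n * 2 ^ (n / 2 ∸ 2)
  count-balanced 2p≡n = begin
    2 * n * classCount
      ≡⟨ trans (*-comm (2 * n) classCount) (cong (classCount *_) (*-comm 2 n)) ⟩
    classCount * (n * 2)
      ≡⟨ burnside-count ⟩
    fixedTotal
      ≡⟨ ∑-cong (allFin n) (λ k → cong₂ _+_ (fixedWithIndex-reflection-half p≤n n∸p≤p p≡n∸p k)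
                                            (fixedWithIndex-rotation-half p≤n n∸p≤p p≡n∸p k)) ⟩
    ∑[ k ∈ allFin n ] (reflectionFixedCount (toℕ k) + rotationFixedCount k p)
      ≡⟨ ∑-+ (allFin n) _ _ ⟩
    ∑[ k ∈ allFin n ] reflectionFixedCount (toℕ k) + rotationFixedTotal p
      ≡⟨ cong₂ _+_ (∑-reflectionFixedCount p n≡p+p) (rotationFixedTotal≡divisorSum p) ⟩
    p * 2 ^ p + divisorSum (gcd n p) (term n p)
      ≡⟨ +-comm (p * 2 ^ p) _ ⟩
    divisorSum (gcd n p) (term n p) + p * 2 ^ p
      ≡⟨ cong₂ (λ q r → divisorSum (gcd n q) (term n q) + r) (sym n/2≡p) power ⟩
    divisorSum (gcd n (n / 2)) (term n (n / 2)) + 2 * n * 2 ^ (n / 2 ∸ 2)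
      ∎
    where
    n≡p+p : n ≡ p + p
    n≡p+p = trans (sym 2p≡n) (cong (p +_) (+-identityʳ p))
    p≡n∸p : p ≡ n ∸ p
    p≡n∸p = sym (trans (cong (_∸ p) n≡p+p) (m+n∸m≡n p p))
    n/2≡p : n / 2 ≡ p
    n/2≡p = trans (cong (_/ 2) (trans (sym 2p≡n) (*-comm 2 p))) (m*n/n≡m p 2)
    2≤p : 2 ≤ p
    2≤p = ≮⇒≥ λ p<2 → <⇒≱ (subst (3 ≤_) (sym 2p≡n) 3≤n) (*-monoʳ-≤ 2 (≤-pred p<2))
    power : p * 2 ^ p ≡ 2 * n * 2 ^ (n / 2 ∸ 2)
    power = trans (p*2^p≡2*[2*p]*2^[p∸2] p 2≤p) (cong₂ (λ m q → 2 * m * 2 ^ (q ∸ 2)) 2p≡n (sym n/2≡p))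

proposition6p4 : (n p : ℕ) → 3 ≤ n → ⌈ n /2⌉ ≤ p → p ≤ n →
    Σ ℕ λ N → IsoClassCount n p N
    × (2 * p ≢ n → n * N ≡ divisorSum (gcd n p) (term n p))
    × (2 * p ≡ n → 2 * n * N ≡ divisorSum (gcd n (n / 2)) (term n (n / 2)) + 2 * n * 2 ^ (n / 2 ∸ 2))
proposition6p4 n p 3≤n ⌈n/2⌉≤p p≤n = classCount , isoClassCount , count-unbalanced , count-balanced
  where
  instance
    n-nonZero : NonZero n
    n-nonZero = >-nonZero (≤-trans (s≤s z≤n) 3≤n)
  open IsomorphismClasses n 3≤n p p≤n (⌈n/2⌉≤p⇒n∸p≤p ⌈n/2⌉≤p)
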